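{- Let $\widetilde{\mathbf{b}}$ be a generic cost vector such that the linear system $(M\ I)\mathbf{x}=\widetilde{\mathbf{b}}_B$ has a non-negative solution. Then there exists $S\subset\{1,\ldots,d-1\}$ with $|S|\geq\lfloor(d-1)/6\rfloor$ such that, for any $\sigma\subseteq S$, there exists a spanning tree $T_{\sigma}$ of $G_d$ which satisfies the following: (A) $T_{\sigma}$ contains the arc set $\{(i,i+1)\ |\ i\in S\setminus\sigma\}$ and does not contain any arc in $\{(j,j+1)\ |\ j\in\sigma\}$, and (B) $(1,\overline{T_{\sigma}})$ is a standard pair of $in_{\widetilde{\mathbf{b}}}(I_{(I\ -M^{\rm T})})$, where $\overline{T_{\sigma}}:=E\setminus T_{\sigma}$ is the co-tree of $T_{\sigma}$. In particular, since $T_{\sigma}\neq T_{\tau}$ for any distinct $\sigma,\tau\subseteq S$, the initial ideal $in_{\widetilde{\mathbf{b}}}(I_{(I\ -M^{\rm T})})$ has at least $\Omega(2^{\lfloor d/6\rfloor})$ standard pairs for any such generic $\widetilde{\mathbf{b}}$ (i.e. any generic $\widetilde{\mathbf{b}}$ for which $(M\ I)\mathbf{x}=\widetilde{\mathbf{b}}_B$ has a non-negative solution).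
   Context: $G_d=(V,E)$ is the acyclic tournament graph with vertices $1,\ldots,d$ and $n=\binom{d}{2}$ arcs $(i,j)$, $i<j$, directed from $i$ to $j$. The minimum cost flow problem is rewritten with respect to the spanning tree $\{(1,2),(2,3),\ldots,(d-1,d)\}$: $(M\ I)\in\mathbb{Z}^{(d-1)\times n}$ is the fundamental cutset matrix and $(I\ -M^{\rm T})\in\mathbb{Z}^{(n-d+1)\times n}$ is the fundamental circuit matrix for this tree. The vector $\widetilde{\mathbf{b}}=(\widetilde{b}_{i,j})_{1\le i<j\le d}$ has $\widetilde{\mathbf{b}}_B=(\widetilde{b}_{i,i+1})_{1\le i<d}$ and $\widetilde{b}_{i,j}=0$ for $j>i+1$; it is used as a cost vector for the dual problem $\min\{\widetilde{\mathbf{b}}_B^{\rm T}\mathbf{y}''\ |\ I\mathbf{y}'-M^{\rm T}\mathbf{y}''=\widetilde{\mathbf{c}},\ \mathbf{y}',\mathbf{y}''\ge 0\}$ (generic means each integer program in the family has a unique optimum). $I_{(I\ -M^{\rm T})}\subseteq k[x_{i,j}\ |\ 1\le i<j\le d]$ is the toric ideal $\langle \mathbf{x}^{\mathbf{u}}-\mathbf{x}^{\mathbf{v}}\ |\ (I\ -M^{\rm T})\mathbf{u}=(I\ -M^{\rm T})\mathbf{v},\ \mathbf{u},\mathbf{v}\in\mathbb{N}^n\rangle$, whose circuits correspond to the cutsets of $G_d$; $in_{\widetilde{\mathbf{b}}}$ denotes its initial ideal with respect to $\widetilde{\mathbf{b}}$ (a term order under the non-negativity condition). A standard pair $(\mathbf{x}^{\mathbf{a}},\sigma)$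 of an initial ideal is a monomial and index set with $\mathrm{supp}(\mathbf{a})\cap\sigma=\emptyset$, all monomials in $\mathbf{x}^{\mathbf{a}}k[x_j\ |\ j\in\sigma]$ outside the initial ideal, and maximal with respect to this property. For $\sigma\subseteq E$, $\mathbf{x}^{\sigma}:=\prod_{(i,j)\in\sigma}x_{i,j}$; $(1,\sigma)$ is a standard pair iff $\sigma$ is a co-tree of $G_d$ with $\mathbf{x}^{\sigma}\notin in_{\widetilde{\mathbf{b}}}(I_{(I\ -M^{\rm T})})$. -}

module Defs where

open import Data.Bool using (Bool; true; false)
open import Data.Nat as ℕ using (ℕ; zero; suc)
import Data.Nat.Properties as ℕP
open import Data.Integer as ℤ using (ℤ; +_; -_)
open import Data.Fin as Fin using (Fin; toℕ)
import Data.Fin.Properties as FinP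
open import Data.Product using (Σ; Σ-syntax; ∃; ∃-syntax; _×_; _,_; proj₁; proj₂)
open import Data.Sum using (_⊎_)
open import Data.List using (List; []; _∷_; _++_; length)
open import Data.List.Relation.Unary.Linked using (Linked)
open import Data.List.Relation.Unary.Unique.Propositional using (Unique)
open import Relation.Binary.Construct.Closure.ReflexiveTransitive using (Star)
open import Relation.Binary.PropositionalEquality using (_≡_)
open import Relation.Nullary using (¬_; Dec; yes; no)
open import Relation.Nullary.Decidable using (_×-dec_)

-- The acyclic tournament G_d.  Vertices 1,…,d of the paper are Fin d
-- (paper vertex i  ↔  Fin element with toℕ = i - 1).  An arc is a pair
-- (i , j) with i < j, directed from i to j.

Arc : ℕ → Set
Arc d = Σ[ i ∈ Fin d ] Σ[ j ∈ Fin d ] i Fin.< j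

tail : ∀ {d} → Arc d → Fin d
tail (i , _ , _) = i

head : ∀ {d} → Arc d → Fin d
head (_ , j , _) = j

IsTreeArc : ∀ {d} → Arc d → Set
IsTreeArc a = toℕ (head a) ≡ suc (toℕ (tail a))

isTreeArc? : ∀ {d} (a : Arc d) → Dec (IsTreeArc a)
isTreeArc? a = toℕ (head a) ℕ.≟ suc (toℕ (tail a))

TreeArc : ℕ → Set
TreeArc d = Σ (Arc d) IsTreeArc

NonTreeArc : ℕ → Set
NonTreeArc d = Σ (Arc d) (λ a → ¬ IsTreeArc a)

-- the path arc with index k ∈ {0,…,d-2}, i.e. paper's arc (k+1, k+2)
IsPathArc : ∀ {d} → Fin (d ℕ.∸ 1) → Arc d → Set
IsPathArc k a = (toℕ (tail a) ≡ toℕ k) × (toℕ (head a) ≡ suc (toℕ k))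

sameArc? : ∀ {d} (a c : Arc d) → Dec ((tail a ≡ tail c) × (head a ≡ head c))
sameArc? a c = (tail a Fin.≟ tail c) ×-dec (head a Fin.≟ head c)

sumFin : (n : ℕ) → (Fin n → ℤ) → ℤ
sumFin zero    f = + 0
sumFin (suc n) f = f Fin.zero ℤ.+ sumFin n (λ i → f (Fin.suc i))

arcTerm : ∀ {d} → (Arc d → ℤ) → Fin d → Fin d → ℤ
arcTerm f i j with i FinP.<? j
... | yes p = f (i , j , p)
... | no  _ = + 0

sumArcs : ∀ {d} → (Arc d → ℤ) → ℤ
sumArcs {d} f = sumFin d (λ i → sumFin d (λ j → arcTerm f i j))

-- entry of the fundamental cutset matrix for tree arc t = (k,k+1) and arc
-- a = (i,j): a lies in the fundamental cutset of t iff i ≤ k < j; all arcs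
-- are oriented the same way as t across the cut, so the entry is 1.
cutEntry : ∀ {d} → Arc d → Arc d → ℤ
cutEntry t a with (toℕ (tail a) ℕ.≤? toℕ (tail t)) ×-dec (toℕ (tail t) ℕ.<? toℕ (head a))
... | yes _ = + 1
... | no  _ = + 0

-- (M I) ∈ ℤ^{(d-1) × n}: rows = tree arcs, columns = all arcs
cutsetMatrix : ∀ {d} → TreeArc d → Arc d → ℤ
cutsetMatrix (t , _) a = cutEntry t a

-- (I  -Mᵀ) ∈ ℤ^{(n-d+1) × n}: rows = non-tree arcs, columns = all arcs
circuitMatrix : ∀ {d} → NonTreeArc d → Arc d → ℤ
circuitMatrix (r , _) c with isTreeArc? c
... | yes _ = - cutEntry c r
... | no  _ with sameArc? c r
...   | yes _ = + 1
...   | no  _ = + 0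

mulVec : ∀ {d} {R : Set} → (R → Arc d → ℤ) → (Arc d → ℕ) → R → ℤ
mulVec A u r = sumArcs (λ c → A r c ℤ.* + u c)

cost : ∀ {d} → (Arc d → ℤ) → (Arc d → ℕ) → ℤ
cost w u = sumArcs (λ a → w a ℤ.* + u a)

btilde : ∀ {d} → (TreeArc d → ℤ) → Arc d → ℤ
btilde bB a with isTreeArc? a
... | yes p = bB (a , p)
... | no  _ = + 0

SameFiber : ∀ {d} {R : Set} → (R → Arc d → ℤ) → (Arc d → ℕ) → (Arc d → ℕ) → Set
SameFiber A u v = ∀ r → mulVec A u r ≡ mulVec A v r

Optimal : ∀ {d} {R : Set} → (R → Arc d → ℤ) → (Arc d → ℤ) → (Arc d → ℕ) → Set
Optimal A w u = ∀ v → SameFiber A v u → cost w u ℤ.≤ cost w v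

Generic : ∀ {d} {R : Set} → (R → Arc d → ℤ) → (Arc d → ℤ) → Set
Generic A w = ∀ u v → SameFiber A u v → Optimal A w u → Optimal A w v →
              ∀ a → u a ≡ v a

-- x^u ∈ in_w(I_A)  (for generic w: x^u is the leading term of some
-- binomial x^u - x^v ∈ I_A, i.e. some v in the same fiber is cheaper)
InInitialIdeal : ∀ {d} {R : Set} → (R → Arc d → ℤ) → (Arc d → ℤ) → (Arc d → ℕ) → Set
InInitialIdeal A w u = ∃[ v ] (SameFiber A v u × (cost w v ℤ.< cost w u))

-- Standard pairs of a monomial ideal J (given by its membership predicate
-- on exponent vectors).  Index sets σ ⊆ E are Bool-valued functions.

_⊕_ : ∀ {d} → (Arc d → ℕ) → (Arc d → ℕ) → Arc d → ℕ
(u ⊕ v) a = u a ℕ.+ v a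

Admissible : ∀ {d} → ((Arc d → ℕ) → Set) → (Arc d → ℕ) → (Arc d → Bool) → Set
Admissible J a σ =
  (∀ e → σ e ≡ true → a e ≡ 0) ×
  (∀ w → (∀ e → σ e ≡ false → w e ≡ 0) → ¬ J (a ⊕ w))

-- (x^a, σ) ≤ (x^b, τ)  iff  x^b ∣ x^a and supp(x^a / x^b) ∪ σ ⊆ τ
PairLeq : ∀ {d} → (Arc d → ℕ) → (Arc d → Bool) → (Arc d → ℕ) → (Arc d → Bool) → Set
PairLeq a σ b τ =
  (∀ e → b e ℕ.≤ a e) ×
  (∀ e → (b e ℕ.< a e ⊎ σ e ≡ true) → τ e ≡ true)

StandardPair : ∀ {d} → ((Arc d → ℕ) → Set) → (Arc d → ℕ) → (Arc d → Bool) → Set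
StandardPair J a σ =
  Admissible J a σ ×
  (∀ b τ → Admissible J b τ → PairLeq a σ b τ →
     (∀ e → b e ≡ a e) × (∀ e → τ e ≡ σ e))

-- Spanning trees of (the underlying undirected graph of) G_d.
-- T ⊆ E given as a Bool-valued function on arcs.

Adjacent : ∀ {d} → (Arc d → Bool) → Fin d → Fin d → Set
Adjacent T u v = ∃[ a ] (T a ≡ true ×
  (((tail a ≡ u) × (head a ≡ v)) ⊎ ((tail a ≡ v) × (head a ≡ u))))

Connected : ∀ {d} → (Arc d → Bool) → Set
Connected T = ∀ u v → Star (Adjacent T) u v

Acyclic : ∀ {d} → (Arc d → Bool) → Set
Acyclic T = ∀ v ws → 2 ℕ.≤ length ws → Unique (v ∷ ws) →
            ¬ Linked (Adjacent T) (v ∷ ws ++ v ∷ [])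

SpanningTree : ∀ {d} → (Arc d → Bool) → Set
SpanningTree T = Connected T × Acyclic T

coTree : ∀ {d} → (Arc d → Bool) → Arc d → Bool
coTree T a with T a
... | true  = false
... | false = true

zeroVec : ∀ {d} → Arc d → ℕ
zeroVec _ = 0

{-# OPTIONS --safe #-}
-- Index the path arcs (k, k+1) by k and write b k for their costs; the nonnegative solution of
-- (M I) x = b̃_B makes every b k nonnegative.  Two vectors lie in the same fibre of (I −Mᵀ) exactly
-- when their difference is a coboundary q (head) − q (tail), and the b̃-cost only sees path arcs.
-- S takes one index t from each block of six consecutive path arcs with b t ≤ b (t − 1) or
-- b t ≤ b (t + 1).  For σ ⊆ S, T_σ is the path with each arc (t, t+1), t ∈ σ, replaced by the bypass
-- (t−1, t+1) or (t, t+2) over a neighbour of cost at least b t; the indices of S are three apart, so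
-- the bypasses do not interact and T_σ is a spanning tree.
-- Admissibility of (1, co-T_σ): moving b t onto its bypass writes the cost difference of two vectors
-- in a fibre as a nonnegative combination of their differences along the arcs of T_σ.
-- Maximality: every arc e of T_σ is the only tree arc crossing some cut, entering some vertex or
-- leaving some vertex, and the corresponding potential produces a second optimum in the fibre of
-- the indicator of co-T_σ ∪ {e}, which genericity forbids.
module Submission where

open import Defs
open import Data.Bool using (true; false)
open import Data.Nat using (ℕ; _≤_; _∸_)
open import Data.Nat.DivMod using (_/_)
open import Data.Integer using (ℤ)
open import Data.Fin using (Fin)
open import Data.Fin.Subset using (Subset; _⊆_; _∈_; _∉_; ∣_∣)
open import Data.Product using (∃; ∃-syntax; _×_)
open import Relation.Binary.PropositionalEquality using (_≡_)

open import Data.Bool using (Bool; if_then_else_; _∧_; _∨_; not)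
open import Data.Bool.Properties
  using (if-cong; if-cong-then; if-eta; if-∧; if-swap-then; ¬-not; ∧-zeroʳ; ∨-zeroʳ;
         ∧-conicalˡ; ∧-conicalʳ; ∨-conicalˡ; ∨-conicalʳ)
open import Data.Empty using (⊥; ⊥-elim)
open import Data.Fin as Fin using (toℕ)
import Data.Fin.Properties as FinP
open import Data.Fin.Subset using (_⊂_)
open import Data.Fin.Subset.Properties using (p⊂q⇒∣p∣<∣q∣)
open import Data.Integer as ℤ using (+_; -_; _+_; _*_; _-_)
import Data.Integer.Properties as ℤP
open import Algebra.Properties.CommutativeMonoid.Sum ℤP.+-0-commutativeMonoid
  using (sum; sum-cong-≗; ∑-distrib-+; sum-init-last; sum-replicate-zero)
open import Data.Integer.Tactic.RingSolver using (solve-∀)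
open import Data.List using (List; []; _∷_; _++_; length)
open import Data.List.Relation.Unary.All as All using (All; []; _∷_)
open import Data.List.Relation.Unary.All.Properties using (++⁻ʳ)
open import Data.List.Relation.Unary.AllPairs using ([]; _∷_)
open import Data.List.Relation.Unary.Linked using (Linked; []; [-]; _∷_)
open import Data.List.Relation.Unary.Linked.Properties using (Linked⇒All)
open import Data.List.Relation.Unary.Unique.Propositional using (Unique)
open import Data.Nat as ℕ using (zero; suc; z≤n; s≤s)
import Data.Nat.Properties as ℕP
open import Data.Nat.DivMod using (m/n*n≤m)
open import Data.Product using (Σ; _,_; proj₁; proj₂)
open import Data.Sum using (_⊎_; inj₁; inj₂)
open import Data.Unit using (⊤; tt)
open import Data.Vec using ([]; _∷_; tabulate; lookup)
import Data.Vec.Properties as VecP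
open import Relation.Binary using (tri<; tri≈; tri>)
open import Relation.Binary.Construct.Closure.ReflexiveTransitive as Star using (Star; ε; _◅_; _◅◅_; return)
open import Relation.Binary.PropositionalEquality
  using (_≢_; refl; sym; trans; cong; cong₂; subst; subst₂; module ≡-Reasoning)
open import Relation.Nullary using (Dec; ¬_; yes; no; does; contradiction)
open import Relation.Nullary.Decidable using (_×-dec_; dec-true; dec-false)

if-does-cong : ∀ {P A : Set} (P? : Dec P) {x y z : A} → (P → x ≡ y) →
  (if does P? then x else z) ≡ (if does P? then y else z)
if-does-cong (yes p) x≡y = x≡y p
if-does-cong (no _)  _   = refl

does-true : ∀ {P : Set} (P? : Dec P) → does P? ≡ true → P
does-true (yes p) _ = p

does-false : ∀ {P : Set} (P? : Dec P) → does P? ≡ false → ¬ P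
does-false (no ¬p) _ = ¬p

clash : ∀ {c : Bool} {A : Set} → c ≡ true → c ≡ false → A
clash c≡true c≡false = contradiction (trans (sym c≡true) c≡false) λ ()

not-true : ∀ {c} → not c ≡ true → c ≡ false
not-true {false} _ = refl

⟦_⟧ : Bool → ℤ
⟦ c ⟧ = if c then + 1 else + 0

⟦⟧-* : ∀ c z → ⟦ c ⟧ * z ≡ (if c then z else + 0)
⟦⟧-* true  z = ℤP.*-identityˡ z
⟦⟧-* false z = ℤP.*-zeroˡ z

⟦⟧-nonneg : ∀ c → + 0 ℤ.≤ ⟦ c ⟧
⟦⟧-nonneg true  = ℤ.+≤+ z≤n
⟦⟧-nonneg false = ℤ.+≤+ z≤n

*-nonneg : ∀ {i j} → + 0 ℤ.≤ i → + 0 ℤ.≤ j → + 0 ℤ.≤ i * j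
*-nonneg {+ m} {+ n} _ _ = subst (+ 0 ℤ.≤_) (ℤP.pos-* m n) (ℤ.+≤+ z≤n)

⟦⟧-diff-≤1 : ∀ c c′ → ⟦ c ⟧ - ⟦ c′ ⟧ ℤ.≤ + 1
⟦⟧-diff-≤1 true  true  = ℤ.+≤+ z≤n
⟦⟧-diff-≤1 true  false = ℤP.≤-refl
⟦⟧-diff-≤1 false true  = ℤ.-≤+
⟦⟧-diff-≤1 false false = ℤ.+≤+ z≤n

⟦⟧-diff-≤0 : ∀ {P Q : Set} (P? : Dec P) (Q? : Dec Q) → (P → Q) → ⟦ does P? ⟧ - ⟦ does Q? ⟧ ℤ.≤ + 0
⟦⟧-diff-≤0 (yes _) (yes _) _   = ℤP.≤-refl
⟦⟧-diff-≤0 (yes p) (no ¬q) p⇒q = contradiction (p⇒q p) ¬q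
⟦⟧-diff-≤0 (no _)  (yes _) _   = ℤ.-≤+
⟦⟧-diff-≤0 (no _)  (no _)  _   = ℤP.≤-refl

⟦⟧-diff-≥0 : ∀ {P Q : Set} (P? : Dec P) (Q? : Dec Q) → (Q → P) → + 0 ℤ.≤ ⟦ does P? ⟧ - ⟦ does Q? ⟧
⟦⟧-diff-≥0 (yes _) (yes _) _   = ℤP.≤-refl
⟦⟧-diff-≥0 (yes _) (no _)  _   = ℤ.+≤+ z≤n
⟦⟧-diff-≥0 (no ¬p) (yes q) q⇒p = contradiction (q⇒p q) ¬p
⟦⟧-diff-≥0 (no _)  (no _)  _   = ℤP.≤-refl

weight : Bool → ℤ → ℤ
weight c z = if c then z else + 0

weight-nonneg : ∀ c {z} → + 0 ℤ.≤ z → + 0 ℤ.≤ weight c z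
weight-nonneg true  z≥0 = z≥0
weight-nonneg false _   = ℤP.≤-refl

sumFin≡sum : ∀ n (f : Fin n → ℤ) → sumFin n f ≡ sum f
sumFin≡sum zero    f = refl
sumFin≡sum (suc n) f = cong (_+_ (f Fin.zero)) (sumFin≡sum n (λ i → f (Fin.suc i)))

sumTo : ℕ → (ℕ → ℤ) → ℤ
sumTo n g = sum {n} (λ i → g (toℕ i))

sumTo-cong : ∀ n {f g : ℕ → ℤ} → (∀ k → k ℕ.< n → f k ≡ g k) → sumTo n f ≡ sumTo n g
sumTo-cong n f≗g = sum-cong-≗ (λ i → f≗g (toℕ i) (FinP.toℕ<n i))

sumTo-+ : ∀ n (f g : ℕ → ℤ) → sumTo n (λ k → f k + g k) ≡ sumTo n f + sumTo n g
sumTo-+ n f g = ∑-distrib-+ {n} (λ i → f (toℕ i)) (λ i → g (toℕ i))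

sumTo-neg : ∀ n (f : ℕ → ℤ) → sumTo n (λ k → - f k) ≡ - sumTo n f
sumTo-neg zero    f = refl
sumTo-neg (suc n) f = begin
  - f 0 + sumTo n (λ k → - f (suc k)) ≡⟨ cong (_+_ (- f 0)) (sumTo-neg n (λ k → f (suc k))) ⟩
  - f 0 - sumTo n (λ k → f (suc k))   ≡⟨ ℤP.neg-distrib-+ (f 0) _ ⟨
  - sumTo (suc n) f                   ∎
  where open ≡-Reasoning

sumTo-- : ∀ n (f g : ℕ → ℤ) → sumTo n (λ k → f k - g k) ≡ sumTo n f - sumTo n g
sumTo-- n f g = trans (sumTo-+ n f (λ k → - g k)) (cong (_+_ (sumTo n f)) (sumTo-neg n g))

sumTo-zero : ∀ n {f : ℕ → ℤ} → (∀ k → k ℕ.< n → f k ≡ + 0) → sumTo n f ≡ + 0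
sumTo-zero n f≗0 = trans (sumTo-cong n f≗0) (sum-replicate-zero n)

sumTo-nonneg : ∀ n {f : ℕ → ℤ} → (∀ k → k ℕ.< n → + 0 ℤ.≤ f k) → + 0 ℤ.≤ sumTo n f
sumTo-nonneg zero    f≥0 = ℤP.≤-refl
sumTo-nonneg (suc n) f≥0 =
  ℤP.+-mono-≤ (f≥0 0 (s≤s z≤n)) (sumTo-nonneg n (λ k k<n → f≥0 (suc k) (s≤s k<n)))

sumTo-last : ∀ n (f : ℕ → ℤ) → sumTo (suc n) f ≡ sumTo n f + f n
sumTo-last n f = begin
  sumTo (suc n) f                                  ≡⟨ sum-init-last {n} (λ i → f (toℕ i)) ⟩
  sum {n} (λ i → f (toℕ (Fin.inject₁ i))) + f (toℕ (Fin.fromℕ n))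
    ≡⟨ cong₂ _+_ (sum-cong-≗ {n} (λ i → cong f (FinP.toℕ-inject₁ i))) (cong f (FinP.toℕ-fromℕ n)) ⟩
  sumTo n f + f n                                  ∎
  where open ≡-Reasoning

sumTo-point : ∀ n m (f : ℕ → ℤ) →
  sumTo n (λ k → if does (k ℕ.≟ m) then f k else + 0) ≡ (if does (m ℕ.<? n) then f m else + 0)
sumTo-point zero    m       f = refl
sumTo-point (suc n) zero    f = trans (cong (_+_ (f 0)) (sumTo-zero n (λ _ _ → refl))) (ℤP.+-identityʳ (f 0))
sumTo-point (suc n) (suc m) f = trans (ℤP.+-identityˡ _) (sumTo-point n m (λ k → f (suc k)))

sumTo-telescope : ∀ n (p : ℕ → ℤ) → sumTo n (λ i → p (suc i) - p i) ≡ p n - p 0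
sumTo-telescope zero    p = sym (ℤP.+-inverseʳ (p 0))
sumTo-telescope (suc n) p = begin
  sumTo (suc n) (λ i → p (suc i) - p i)         ≡⟨ sumTo-last n (λ i → p (suc i) - p i) ⟩
  sumTo n (λ i → p (suc i) - p i) + (p (suc n) - p n) ≡⟨ cong (_+ (p (suc n) - p n)) (sumTo-telescope n p) ⟩
  (p n - p 0) + (p (suc n) - p n)               ≡⟨ cancel (p n) (p 0) (p (suc n)) ⟩
  p (suc n) - p 0                               ∎
  where
  open ≡-Reasoning
  cancel : ∀ a b c → (a - b) + (c - a) ≡ c - b
  cancel = solve-∀

sumTo-below : ∀ {n y} (f : ℕ → ℤ) → y ℕ.≤ n → sumTo n (λ k → if does (k ℕ.<? y) then f k else + 0) ≡ sumTo y f
sumTo-below {n}     {zero}  f _         = sumTo-zero n (λ _ _ → refl)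
sumTo-below {suc n} {suc y} f (s≤s y≤n) = cong (_+_ (f 0)) (sumTo-below (λ k → f (suc k)) y≤n)

sumBetween : ℕ → ℕ → (ℕ → ℤ) → ℤ
sumBetween x y f = sumTo (y ∸ x) (λ i → f (x ℕ.+ i))

sumTo-between : ∀ {n x y} (f : ℕ → ℤ) → y ℕ.≤ n →
  sumTo n (λ k → if does (x ℕ.≤? k ×-dec k ℕ.<? y) then f k else + 0) ≡ sumBetween x y f
sumTo-between {n}     {zero}  f y≤n       = sumTo-below f y≤n
sumTo-between {zero}  {suc x} f z≤n       = refl
sumTo-between {suc n} {suc x} {zero}  f _ =
  sumTo-zero (suc n) (λ k _ → if-cong {x = f k} (∧-zeroʳ (does (suc x ℕ.≤? k))))
sumTo-between {suc n} {suc zero} {suc y} f (s≤s y≤n) =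
  trans (ℤP.+-identityˡ _) (sumTo-between {n} {zero} {y} (λ k → f (suc k)) y≤n)
sumTo-between {suc n} {suc (suc x)} {suc y} f (s≤s y≤n) =
  trans (ℤP.+-identityˡ _) (sumTo-between {n} {suc x} {y} (λ k → f (suc k)) y≤n)

sumBetween-cong : ∀ {x y} {f g : ℕ → ℤ} → x ℕ.≤ y → (∀ {k} → x ℕ.≤ k → k ℕ.< y → f k ≡ g k) →
  sumBetween x y f ≡ sumBetween x y g
sumBetween-cong {x} {y} x≤y f≗g = sumTo-cong (y ∸ x) (λ i i<y∸x →
  f≗g (ℕP.m≤m+n x i) (subst (x ℕ.+ i ℕ.<_) (ℕP.m+[n∸m]≡n x≤y) (ℕP.+-monoʳ-< x i<y∸x)))

sumBetween-telescope : ∀ {x y} (q : ℕ → ℤ) → x ℕ.≤ y → sumBetween x y (λ k → q (suc k) - q k) ≡ q y - q x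
sumBetween-telescope {x} {y} q x≤y = begin
  sumTo (y ∸ x) (λ i → q (suc (x ℕ.+ i)) - q (x ℕ.+ i))
    ≡⟨ sumTo-cong (y ∸ x) (λ i _ → cong (λ z → q z - q (x ℕ.+ i)) (ℕP.+-suc x i)) ⟨
  sumTo (y ∸ x) (λ i → q (x ℕ.+ suc i) - q (x ℕ.+ i))
    ≡⟨ sumTo-telescope (y ∸ x) (λ i → q (x ℕ.+ i)) ⟩
  q (x ℕ.+ (y ∸ x)) - q (x ℕ.+ 0)
    ≡⟨ cong₂ (λ u v → q u - q v) (ℕP.m+[n∸m]≡n x≤y) (ℕP.+-identityʳ x) ⟩
  q y - q x ∎
  where open ≡-Reasoning

sumBetween-two : ∀ x (f : ℕ → ℤ) → sumBetween x (2 ℕ.+ x) f ≡ f x + f (suc x)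
sumBetween-two x f = begin
  sumTo (2 ℕ.+ x ∸ x) (λ i → f (x ℕ.+ i)) ≡⟨ cong (λ n → sumTo n (λ i → f (x ℕ.+ i))) (ℕP.m+n∸n≡m 2 x) ⟩
  f (x ℕ.+ 0) + (f (x ℕ.+ 1) + + 0)       ≡⟨ cong₂ (λ u v → f u + v) (ℕP.+-identityʳ x)
                                               (trans (ℤP.+-identityʳ _) (cong f (ℕP.+-comm x 1))) ⟩
  f x + f (suc x)                          ∎
  where open ≡-Reasoning

shift : (ℕ → ℤ) → ℕ → ℤ
shift f zero    = + 0
shift f (suc k) = f k

sumTo-shift : ∀ n (f g : ℕ → ℤ) → g n ≡ + 0 → sumTo n (λ k → shift f k * g k) ≡ sumTo n (λ k → f k * g (suc k))
sumTo-shift zero    f g _      = refl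
sumTo-shift (suc n) f g g[n]≡0 = begin
  + 0 * g 0 + sumTo n (λ k → f k * g (suc k))    ≡⟨ cong (_+ sumTo n (λ k → f k * g (suc k))) (ℤP.*-zeroˡ (g 0)) ⟩
  + 0 + sumTo n (λ k → f k * g (suc k))          ≡⟨ ℤP.+-identityˡ _ ⟩
  sumTo n (λ k → f k * g (suc k))                ≡⟨ ℤP.+-identityʳ _ ⟨
  sumTo n (λ k → f k * g (suc k)) + + 0          ≡⟨ cong (λ z → sumTo n (λ k → f k * g (suc k)) + z)
                                                      (trans (cong (f n *_) g[n]≡0) (ℤP.*-zeroʳ (f n))) ⟨
  sumTo n (λ k → f k * g (suc k)) + f n * g (suc n) ≡⟨ sumTo-last n (λ k → f k * g (suc k)) ⟨
  sumTo (suc n) (λ k → f k * g (suc k))          ∎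
  where open ≡-Reasoning

module ArcPairs (d : ℕ) where

  arc-≡ : {a c : Arc d} → toℕ (tail a) ≡ toℕ (tail c) → toℕ (head a) ≡ toℕ (head c) → a ≡ c
  arc-≡ {i , j , i<j} {i′ , j′ , i′<j′} eq₁ eq₂ with FinP.toℕ-injective eq₁ | FinP.toℕ-injective eq₂
  ... | refl | refl = cong (λ p → i , j , p) (ℕP.<-irrelevant i<j i′<j′)

  arc : ∀ {x y} → x ℕ.< y → y ℕ.< d → Arc d
  arc x<y y<d = Fin.fromℕ< (ℕP.<-trans x<y y<d) , Fin.fromℕ< y<d ,
    subst₂ ℕ._<_ (sym (FinP.toℕ-fromℕ< _)) (sym (FinP.toℕ-fromℕ< _)) x<y

  tail-arc : ∀ {x y} (x<y : x ℕ.< y) (y<d : y ℕ.< d) → toℕ (tail (arc x<y y<d)) ≡ x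
  tail-arc x<y y<d = FinP.toℕ-fromℕ< _

  head-arc : ∀ {x y} (x<y : x ℕ.< y) (y<d : y ℕ.< d) → toℕ (head (arc x<y y<d)) ≡ y
  head-arc x<y y<d = FinP.toℕ-fromℕ< _

  extend : (Arc d → ℤ) → ℕ → ℕ → ℤ
  extend h x y with x ℕ.<? y | y ℕ.<? d
  ... | yes x<y | yes y<d = h (arc x<y y<d)
  ... | _       | _       = + 0

  extend-arc : ∀ h {x y} (x<y : x ℕ.< y) (y<d : y ℕ.< d) → extend h x y ≡ h (arc x<y y<d)
  extend-arc h {x} {y} x<y y<d with x ℕ.<? y | y ℕ.<? d
  ... | yes _    | yes _    = cong h (arc-≡ refl refl)
  ... | no x≮y   | _        = contradiction x<y x≮y
  ... | yes _    | no y≮d   = contradiction y<d y≮d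

  extend-endpoints : ∀ h a → extend h (toℕ (tail a)) (toℕ (head a)) ≡ h a
  extend-endpoints h a@(_ , _ , i<j) =
    trans (extend-arc h i<j j<d) (cong h (arc-≡ (tail-arc i<j j<d) (head-arc i<j j<d)))
    where
    j<d = FinP.toℕ<n (head a)

  extend-outside : ∀ h {x y} → d ℕ.≤ y → extend h x y ≡ + 0
  extend-outside h {x} {y} d≤y with x ℕ.<? y | y ℕ.<? d
  ... | yes _ | yes y<d = contradiction y<d (ℕP.≤⇒≯ d≤y)
  ... | yes _ | no _    = refl
  ... | no _  | _       = refl

  sumPairs : (ℕ → ℕ → ℤ) → ℤ
  sumPairs H = sumTo d (λ x → sumTo d (λ y → if does (x ℕ.<? y) then H x y else + 0))

  sumArcs-pairs : ∀ h H → (∀ a → h a ≡ H (toℕ (tail a)) (toℕ (head a))) → sumArcs h ≡ sumPairs H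
  sumArcs-pairs h H h≗H =
    trans (sumFin≡sum d _)
          (sum-cong-≗ {d} (λ i → trans (sumFin≡sum d (arcTerm h i)) (sum-cong-≗ {d} (arcTerm-pairs i))))
    where
    arcTerm-pairs : ∀ i j → arcTerm h i j ≡ (if does (toℕ i ℕ.<? toℕ j) then H (toℕ i) (toℕ j) else + 0)
    arcTerm-pairs i j with i FinP.<? j
    ... | yes i<j = trans (h≗H (i , j , i<j)) (sym (if-cong (dec-true (toℕ i ℕ.<? toℕ j) i<j)))
    ... | no i≮j  = sym (if-cong (dec-false (toℕ i ℕ.<? toℕ j) i≮j))

  sumPairs-cong : ∀ {F G : ℕ → ℕ → ℤ} → (∀ {x y} → x ℕ.< y → y ℕ.< d → F x y ≡ G x y) → sumPairs F ≡ sumPairs G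
  sumPairs-cong F≗G =
    sumTo-cong d (λ x _ → sumTo-cong d (λ y y<d → if-does-cong (x ℕ.<? y) (λ x<y → F≗G x<y y<d)))

  sumPairs-+ : ∀ (F G : ℕ → ℕ → ℤ) → sumPairs (λ x y → F x y + G x y) ≡ sumPairs F + sumPairs G
  sumPairs-+ F G =
    trans (sumTo-cong d (λ x _ → trans (sumTo-cong d (λ y _ → split x y)) (sumTo-+ d (row F x) (row G x))))
          (sumTo-+ d (λ x → sumTo d (row F x)) (λ x → sumTo d (row G x)))
    where
    row : (ℕ → ℕ → ℤ) → ℕ → ℕ → ℤ
    row H x y = if does (x ℕ.<? y) then H x y else + 0
    split : ∀ x y → (if does (x ℕ.<? y) then F x y + G x y else + 0)
                  ≡ (if does (x ℕ.<? y) then F x y else + 0) + (if does (x ℕ.<? y) then G x y else + 0)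
    split x y with does (x ℕ.<? y)
    ... | true  = refl
    ... | false = refl

  sumPairs-path : ∀ (F : ℕ → ℤ) → sumPairs (λ x y → if does (y ℕ.≟ suc x) then F x else + 0) ≡
                        sumTo d (λ x → if does (suc x ℕ.<? d) then F x else + 0)
  sumPairs-path F =
    sumTo-cong d (λ x _ → trans (sumTo-cong d (λ y _ → drop-order x y)) (sumTo-point d (suc x) (λ _ → F x)))
    where
    drop-order : ∀ x y → (if does (x ℕ.<? y) then (if does (y ℕ.≟ suc x) then F x else + 0) else + 0)
                       ≡ (if does (y ℕ.≟ suc x) then F x else + 0)
    drop-order x y = trans (if-swap-then (does (x ℕ.<? y)) (does (y ℕ.≟ suc x)))
      (if-does-cong (y ℕ.≟ suc x) (λ { refl → if-cong (dec-true (x ℕ.<? suc x) (ℕP.n<1+n x)) }))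

  sumPairs-point : ∀ (F : ℕ → ℕ → ℤ) {x₀ y₀} → x₀ ℕ.< y₀ → y₀ ℕ.< d →
    sumPairs (λ x y → if does (x ℕ.≟ x₀) then (if does (y ℕ.≟ y₀) then F x y else + 0) else + 0) ≡ F x₀ y₀
  sumPairs-point F {x₀} {y₀} x₀<y₀ y₀<d = begin
    sumPairs (λ x y → [ x ≟x₀] ([ y ≟y₀] (F x y)))
      ≡⟨ sumTo-cong d (λ x _ → trans (sumTo-cong d (λ y _ → reorder x y))
                                      (sumTo-point d y₀ (λ y → [ x ≟x₀] (F x y)))) ⟩
    sumTo d (λ x → if does (y₀ ℕ.<? d) then [ x ≟x₀] (F x y₀) else + 0)
      ≡⟨ sumTo-cong d (λ x _ → if-cong {x = [ x ≟x₀] (F x y₀)} (dec-true (y₀ ℕ.<? d) y₀<d)) ⟩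
    sumTo d (λ x → [ x ≟x₀] (F x y₀))
      ≡⟨ sumTo-point d x₀ (λ x → F x y₀) ⟩
    (if does (x₀ ℕ.<? d) then F x₀ y₀ else + 0)
      ≡⟨ if-cong (dec-true (x₀ ℕ.<? d) (ℕP.<-trans x₀<y₀ y₀<d)) ⟩
    F x₀ y₀ ∎
    where
    open ≡-Reasoning
    [_≟x₀] : ℕ → ℤ → ℤ
    [ x ≟x₀] z = if does (x ℕ.≟ x₀) then z else + 0
    [_≟y₀] : ℕ → ℤ → ℤ
    [ y ≟y₀] z = if does (y ℕ.≟ y₀) then z else + 0
    [_<_] : ℕ → ℕ → ℤ → ℤ
    [ x < y ] z = if does (x ℕ.<? y) then z else + 0
    reorder : ∀ x y → [ x < y ] ([ x ≟x₀] ([ y ≟y₀] (F x y))) ≡ [ y ≟y₀] ([ x ≟x₀] (F x y))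
    reorder x y = begin
      [ x < y ] ([ x ≟x₀] ([ y ≟y₀] (F x y)))
        ≡⟨ if-swap-then (does (x ℕ.<? y)) (does (x ℕ.≟ x₀)) ⟩
      [ x ≟x₀] ([ x < y ] ([ y ≟y₀] (F x y)))
        ≡⟨ if-does-cong (x ℕ.≟ x₀) (λ { refl → if-swap-then (does (x ℕ.<? y)) (does (y ℕ.≟ y₀)) }) ⟩
      [ x ≟x₀] ([ y ≟y₀] ([ x < y ] (F x y)))
        ≡⟨ if-swap-then (does (x ℕ.≟ x₀)) (does (y ℕ.≟ y₀)) ⟩
      [ y ≟y₀] ([ x ≟x₀] ([ x < y ] (F x y)))
        ≡⟨ if-does-cong (y ℕ.≟ y₀) (λ { refl → if-does-cong (x ℕ.≟ x₀) (λ { refl →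
             if-cong (dec-true (x ℕ.<? y) x₀<y₀) }) }) ⟩
      [ y ≟y₀] ([ x ≟x₀] (F x y)) ∎

  extend-nonneg : ∀ {h} → (∀ a → + 0 ℤ.≤ h a) → ∀ x y → + 0 ℤ.≤ extend h x y
  extend-nonneg h≥0 x y with x ℕ.<? y | y ℕ.<? d
  ... | yes _ | yes _ = h≥0 _
  ... | yes _ | no _  = ℤP.≤-refl
  ... | no _  | _     = ℤP.≤-refl

  sumArcs-nonneg : ∀ {h} → (∀ a → + 0 ℤ.≤ h a) → + 0 ℤ.≤ sumArcs h
  sumArcs-nonneg {h} h≥0 = subst (+ 0 ℤ.≤_) (sym (sumArcs-pairs h (extend h) (λ a → sym (extend-endpoints h a))))
    (sumTo-nonneg d (λ x _ → sumTo-nonneg d (λ y _ → on-arcs (x ℕ.<? y))))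
    where
    on-arcs : ∀ {x y} (x<?y : Dec (x ℕ.< y)) → + 0 ℤ.≤ (if does x<?y then extend h x y else + 0)
    on-arcs {x} {y} (yes _) = extend-nonneg h≥0 x y
    on-arcs         (no _)  = ℤP.≤-refl

  _≟ₐ_ : (a c : Arc d) → Dec (a ≡ c)
  a ≟ₐ c with toℕ (tail a) ℕ.≟ toℕ (tail c) | toℕ (head a) ℕ.≟ toℕ (head c)
  ... | yes t≡ | yes h≡ = yes (arc-≡ t≡ h≡)
  ... | no t≢  | _      = no (λ a≡c → t≢ (cong (λ a → toℕ (tail a)) a≡c))
  ... | yes _  | no h≢  = no (λ a≡c → h≢ (cong (λ a → toℕ (head a)) a≡c))

module CostsAndFibres (d : ℕ) (bB : TreeArc d → ℤ) where

  open ArcPairs d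

  lift : (Arc d → ℕ) → ℕ → ℕ → ℤ
  lift w = extend (λ a → + w a)

  b : ℕ → ℤ
  b k = extend (btilde bB) k (suc k)

  b-outside : ∀ {k} → d ℕ.≤ suc k → b k ≡ + 0
  b-outside {k} = extend-outside (btilde bB) {k}

  btilde-nontree : ∀ a → ¬ IsTreeArc a → btilde bB a ≡ + 0
  btilde-nontree a a∉B with isTreeArc? a
  ... | yes a∈B = contradiction a∈B a∉B
  ... | no  _   = refl

  extend-btilde : ∀ {x y} → x ℕ.< y → y ℕ.< d → extend (btilde bB) x y ≡ (if does (y ℕ.≟ suc x) then b x else + 0)
  extend-btilde {x} {y} x<y y<d = by-cases (y ℕ.≟ suc x)
    where
    by-cases : (y≟1+x : Dec (y ≡ suc x)) → extend (btilde bB) x y ≡ (if does y≟1+x then b x else + 0)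
    by-cases (yes refl) = refl
    by-cases (no y≢1+x) = trans (extend-arc (btilde bB) x<y y<d) (btilde-nontree _ λ a∈B →
      y≢1+x (trans (sym (head-arc x<y y<d)) (trans a∈B (cong suc (tail-arc x<y y<d)))))

  cost-path : ∀ w → cost (btilde bB) w ≡ sumTo d (λ k → b k * lift w k (suc k))
  cost-path w = begin
    cost (btilde bB) w
      ≡⟨ sumArcs-pairs _ (λ x y → extend (btilde bB) x y * lift w x y)
           (λ a → sym (cong₂ _*_ (extend-endpoints (btilde bB) a) (extend-endpoints _ a))) ⟩
    sumPairs (λ x y → extend (btilde bB) x y * lift w x y)
      ≡⟨ sumPairs-cong (λ {x} {y} x<y y<d → trans (cong (_* lift w x y) (extend-btilde x<y y<d)) (on-path (y ℕ.≟ suc x))) ⟩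
    sumPairs (λ x y → if does (y ℕ.≟ suc x) then b x * lift w x (suc x) else + 0)
      ≡⟨ sumPairs-path (λ x → b x * lift w x (suc x)) ⟩
    sumTo d (λ k → if does (suc k ℕ.<? d) then b k * lift w k (suc k) else + 0)
      ≡⟨ sumTo-cong d (λ k _ → in-range (suc k ℕ.<? d)) ⟩
    sumTo d (λ k → b k * lift w k (suc k)) ∎
    where
    open ≡-Reasoning
    on-path : ∀ {x y} (y≟1+x : Dec (y ≡ suc x)) →
      (if does y≟1+x then b x else + 0) * lift w x y ≡ (if does y≟1+x then b x * lift w x (suc x) else + 0)
    on-path (yes refl) = refl
    on-path {x} {y} (no _) = ℤP.*-zeroˡ (lift w x y)
    in-range : ∀ {k} (k+1<?d : Dec (suc k ℕ.< d)) →
      (if does k+1<?d then b k * lift w k (suc k) else + 0) ≡ b k * lift w k (suc k)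
    in-range (yes _)    = refl
    in-range {k} (no k+1≮d) =
      sym (trans (cong (_* lift w k (suc k)) (b-outside (ℕP.≮⇒≥ k+1≮d))) (ℤP.*-zeroˡ (lift w k (suc k))))

  cutEntry-between : ∀ (t a : Arc d) →
    cutEntry t a ≡ ⟦ does (toℕ (tail a) ℕ.≤? toℕ (tail t) ×-dec toℕ (tail t) ℕ.<? toℕ (head a)) ⟧
  cutEntry-between t a with toℕ (tail a) ℕ.≤? toℕ (tail t) ×-dec toℕ (tail t) ℕ.<? toℕ (head a)
  ... | yes p = sym (cong ⟦_⟧ (dec-true (_ ℕ.≤? _ ×-dec _ ℕ.<? _) p))
  ... | no ¬p = sym (cong ⟦_⟧ (dec-false (_ ℕ.≤? _ ×-dec _ ℕ.<? _) ¬p))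

  -- Row (x₀, y₀) of (I −Mᵀ): the arc itself minus the path arcs of its fundamental circuit.
  circuitEntry : ℕ → ℕ → ℕ → ℕ → ℤ
  circuitEntry x₀ y₀ x y =
    if does (y ℕ.≟ suc x) then - ⟦ does (x₀ ℕ.≤? x ×-dec x ℕ.<? y₀) ⟧
    else ⟦ does (x ℕ.≟ x₀ ×-dec y ℕ.≟ y₀) ⟧

  circuitMatrix-pairs : ∀ (r : Arc d) (r∉B : ¬ IsTreeArc r) (c : Arc d) →
    circuitMatrix (r , r∉B) c ≡ circuitEntry (toℕ (tail r)) (toℕ (head r)) (toℕ (tail c)) (toℕ (head c))
  circuitMatrix-pairs r r∉B c with isTreeArc? c
  ... | yes c∈B = trans (cong -_ (cutEntry-between c r)) (sym (if-cong (dec-true (isTreeArc? c) c∈B)))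
  ... | no c∉B with sameArc? c r
  ...   | yes (t≡ , h≡) = sym (trans (if-cong (dec-false (isTreeArc? c) c∉B))
                                     (cong ⟦_⟧ (dec-true (_ ℕ.≟ _ ×-dec _ ℕ.≟ _) (cong toℕ t≡ , cong toℕ h≡))))
  ...   | no  c≢r       = sym (trans (if-cong (dec-false (isTreeArc? c) c∉B))
                                     (cong ⟦_⟧ (dec-false (_ ℕ.≟ _ ×-dec _ ℕ.≟ _) λ (t≡ , h≡) →
                                        c≢r (FinP.toℕ-injective t≡ , FinP.toℕ-injective h≡))))

  circuitEntry-split : ∀ {x₀ y₀} → y₀ ≢ suc x₀ → ∀ (V : ℕ → ℕ → ℤ) x y →
    circuitEntry x₀ y₀ x y * V x y ≡
      (if does (x ℕ.≟ x₀) then (if does (y ℕ.≟ y₀) then V x y else + 0) else + 0) +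
      (if does (y ℕ.≟ suc x) then - (if does (x₀ ℕ.≤? x ×-dec x ℕ.<? y₀) then V x (suc x) else + 0) else + 0)
  circuitEntry-split {x₀} {y₀} y₀≢1+x₀ V x y =
    by-cases (y ℕ.≟ suc x) (x ℕ.≟ x₀) (y ℕ.≟ y₀) (x₀ ℕ.≤? x ×-dec x ℕ.<? y₀)
    where
    on-path : ∀ (B : Dec (x₀ ℕ.≤ x × x ℕ.< y₀)) →
      - ⟦ does B ⟧ * V x (suc x) ≡ + 0 + - (if does B then V x (suc x) else + 0)
    on-path B = trans (sym (ℤP.neg-distribˡ-* ⟦ does B ⟧ _))
                      (trans (cong -_ (⟦⟧-* (does B) _)) (sym (ℤP.+-identityˡ _)))
    by-cases : ∀ (S : Dec (y ≡ suc x)) (X : Dec (x ≡ x₀)) (Y : Dec (y ≡ y₀)) (B : Dec (x₀ ℕ.≤ x × x ℕ.< y₀)) →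
      (if does S then - ⟦ does B ⟧ else ⟦ does (X ×-dec Y) ⟧) * V x y ≡
      (if does X then (if does Y then V x y else + 0) else + 0) +
      (if does S then - (if does B then V x (suc x) else + 0) else + 0)
    by-cases (yes y≡1+x) (yes refl) (yes refl) B = ⊥-elim (y₀≢1+x₀ y≡1+x)
    by-cases (yes refl)  (yes _)    (no _)     B = on-path B
    by-cases (yes refl)  (no _)     Y          B = on-path B
    by-cases (no _)      X          Y          B =
      trans (⟦⟧-* (does X ∧ does Y) _) (trans (if-∧ (does X)) (sym (ℤP.+-identityʳ _)))

  circuit-row : ∀ v (r : Arc d) (r∉B : ¬ IsTreeArc r) →
    mulVec circuitMatrix v (r , r∉B) ≡
      lift v (toℕ (tail r)) (toℕ (head r)) - sumBetween (toℕ (tail r)) (toℕ (head r)) (λ k → lift v k (suc k))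
  circuit-row v r@(_ , j , _) r∉B = begin
    mulVec circuitMatrix v (r , r∉B)
      ≡⟨ sumArcs-pairs (λ c → circuitMatrix (r , r∉B) c * + v c) (λ x y → circuitEntry x₀ y₀ x y * lift v x y)
           (λ c → cong₂ _*_ (circuitMatrix-pairs r r∉B c) (sym (extend-endpoints (λ a → + v a) c))) ⟩
    sumPairs (λ x y → circuitEntry x₀ y₀ x y * lift v x y)
      ≡⟨ sumPairs-cong (λ {x} {y} _ _ → circuitEntry-split (λ y₀≡1+x₀ → r∉B y₀≡1+x₀) (lift v) x y) ⟩
    sumPairs (λ x y → point x y + path x y)
      ≡⟨ sumPairs-+ point path ⟩
    sumPairs point + sumPairs path
      ≡⟨ cong₂ _+_ (sumPairs-point (lift v) (proj₂ (proj₂ r)) (FinP.toℕ<n j)) (sumPairs-path on-path) ⟩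
    lift v x₀ y₀ + sumTo d (λ x → if does (suc x ℕ.<? d) then on-path x else + 0)
      ≡⟨ cong (_+_ (lift v x₀ y₀)) (trans (sumTo-cong d (λ x _ → in-range (suc x ℕ.<? d)))
                                          (sumTo-neg d (λ x → if between x then lift v x (suc x) else + 0))) ⟩
    lift v x₀ y₀ - sumTo d (λ x → if between x then lift v x (suc x) else + 0)
      ≡⟨ cong (_-_ (lift v x₀ y₀)) (sumTo-between {d} {x₀} {y₀} (λ k → lift v k (suc k)) (ℕP.<⇒≤ (FinP.toℕ<n j))) ⟩
    lift v x₀ y₀ - sumBetween x₀ y₀ (λ k → lift v k (suc k)) ∎
    where
    open ≡-Reasoning
    x₀ y₀ : ℕ
    x₀ = toℕ (tail r)
    y₀ = toℕ (head r)
    between : ℕ → Bool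
    between x = does (x₀ ℕ.≤? x ×-dec x ℕ.<? y₀)
    point path : ℕ → ℕ → ℤ
    point x y = if does (x ℕ.≟ x₀) then (if does (y ℕ.≟ y₀) then lift v x y else + 0) else + 0
    path x y = if does (y ℕ.≟ suc x) then - (if between x then lift v x (suc x) else + 0) else + 0
    on-path : ℕ → ℤ
    on-path x = - (if between x then lift v x (suc x) else + 0)
    in-range : ∀ {x} (x+1<?d : Dec (suc x ℕ.< d)) → (if does x+1<?d then on-path x else + 0) ≡ on-path x
    in-range (yes _) = refl
    in-range {x} (no x+1≮d) =
      sym (cong -_ (trans (if-cong-then (between x) (extend-outside (λ a → + v a) {x} (ℕP.≮⇒≥ x+1≮d))) (if-eta (between x))))

  δ : (ℕ → ℤ) → Arc d → ℤ
  δ q a = q (toℕ (head a)) - q (toℕ (tail a))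

  diff : (Arc d → ℕ) → (Arc d → ℕ) → ℕ → ℕ → ℤ
  diff v w x y = lift v x y - lift w x y

  circuit-row-diff : ∀ v w (r : Arc d) (r∉B : ¬ IsTreeArc r) →
    mulVec circuitMatrix v (r , r∉B) - mulVec circuitMatrix w (r , r∉B) ≡
      diff v w (toℕ (tail r)) (toℕ (head r)) - sumBetween (toℕ (tail r)) (toℕ (head r)) (λ k → diff v w k (suc k))
  circuit-row-diff v w r r∉B = begin
    mulVec circuitMatrix v (r , r∉B) - mulVec circuitMatrix w (r , r∉B)
      ≡⟨ cong₂ _-_ (circuit-row v r r∉B) (circuit-row w r r∉B) ⟩
    (lift v x₀ y₀ - path v) - (lift w x₀ y₀ - path w)
      ≡⟨ regroup (lift v x₀ y₀) (path v) (lift w x₀ y₀) (path w) ⟩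
    diff v w x₀ y₀ - (path v - path w)
      ≡⟨ cong (_-_ (diff v w x₀ y₀)) (sumTo-- (y₀ ∸ x₀) (λ i → lift v (x₀ ℕ.+ i) (suc (x₀ ℕ.+ i)))
                                                       (λ i → lift w (x₀ ℕ.+ i) (suc (x₀ ℕ.+ i)))) ⟨
    diff v w x₀ y₀ - sumBetween x₀ y₀ (λ k → diff v w k (suc k)) ∎
    where
    open ≡-Reasoning
    x₀ y₀ : ℕ
    x₀ = toℕ (tail r)
    y₀ = toℕ (head r)
    path : (Arc d → ℕ) → ℤ
    path u = sumBetween x₀ y₀ (λ k → lift u k (suc k))
    regroup : ∀ a b c e → (a - b) - (c - e) ≡ (a - c) - (b - e)
    regroup = solve-∀

  sameFiber-between : ∀ {v w} → SameFiber circuitMatrix v w → ∀ (r : Arc d) → ¬ IsTreeArc r →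
    diff v w (toℕ (tail r)) (toℕ (head r)) ≡ sumBetween (toℕ (tail r)) (toℕ (head r)) (λ k → diff v w k (suc k))
  sameFiber-between {v} {w} v~w r r∉B = ℤP.i-j≡0⇒i≡j _ _
    (trans (sym (circuit-row-diff v w r r∉B)) (ℤP.i≡j⇒i-j≡0 (v~w (r , r∉B))))

  sameFiber-jump : ∀ {v w} → SameFiber circuitMatrix v w → ∀ {x} → 2 ℕ.+ x ℕ.< d →
    diff v w x (2 ℕ.+ x) ≡ diff v w x (suc x) + diff v w (suc x) (2 ℕ.+ x)
  sameFiber-jump {v} {w} v~w {x} x+2<d = begin
    diff v w x (2 ℕ.+ x)                                           ≡⟨ cong₂ (diff v w) (tail-arc x<x+2 x+2<d) (head-arc x<x+2 x+2<d) ⟨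
    diff v w (toℕ (tail jump)) (toℕ (head jump))                   ≡⟨ sameFiber-between v~w jump nontree ⟩
    sumBetween (toℕ (tail jump)) (toℕ (head jump)) (λ k → diff v w k (suc k))
      ≡⟨ cong₂ (λ s t → sumBetween s t (λ k → diff v w k (suc k))) (tail-arc x<x+2 x+2<d) (head-arc x<x+2 x+2<d) ⟩
    sumBetween x (2 ℕ.+ x) (λ k → diff v w k (suc k))              ≡⟨ sumBetween-two x (λ k → diff v w k (suc k)) ⟩
    diff v w x (suc x) + diff v w (suc x) (2 ℕ.+ x)                ∎
    where
    open ≡-Reasoning
    x<x+2 : x ℕ.< 2 ℕ.+ x
    x<x+2 = ℕP.m<n+m x (s≤s z≤n)
    jump : Arc d
    jump = arc x<x+2 x+2<d
    nontree : ¬ IsTreeArc jump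
    nontree jump∈B = ℕP.1+n≢n (suc-injective′ (trans (sym (head-arc x<x+2 x+2<d))
                                   (trans jump∈B (cong suc (tail-arc x<x+2 x+2<d)))))
      where
      suc-injective′ : ∀ {m n} → suc m ≡ suc n → m ≡ n
      suc-injective′ refl = refl

  diff-coboundary : ∀ {v w q} → (∀ a → + v a - + w a ≡ δ q a) →
    ∀ {x y} → x ℕ.< y → y ℕ.< d → diff v w x y ≡ q y - q x
  diff-coboundary {v} {w} {q} v-w≡δq {x} {y} x<y y<d = begin
    diff v w x y
      ≡⟨ cong₂ _-_ (extend-arc (λ a → + v a) x<y y<d) (extend-arc (λ a → + w a) x<y y<d) ⟩
    + v (arc x<y y<d) - + w (arc x<y y<d)       ≡⟨ v-w≡δq (arc x<y y<d) ⟩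
    δ q (arc x<y y<d)                           ≡⟨ cong₂ (λ s t → q s - q t) (head-arc x<y y<d) (tail-arc x<y y<d) ⟩
    q y - q x                                   ∎
    where open ≡-Reasoning

  coboundary⇒sameFiber : ∀ {v w} q → (∀ a → + v a - + w a ≡ δ q a) → SameFiber circuitMatrix v w
  coboundary⇒sameFiber {v} {w} q v-w≡δq (r@(_ , j , i<j) , r∉B) = ℤP.i-j≡0⇒i≡j _ _ (begin
    mulVec circuitMatrix v (r , r∉B) - mulVec circuitMatrix w (r , r∉B)
      ≡⟨ circuit-row-diff v w r r∉B ⟩
    diff v w x₀ y₀ - sumBetween x₀ y₀ (λ k → diff v w k (suc k))
      ≡⟨ cong₂ _-_ (diff-coboundary {v} {w} {q} v-w≡δq i<j y₀<d)
           (sumBetween-cong (ℕP.<⇒≤ i<j) (λ {k} _ k<y₀ →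
              diff-coboundary {v} {w} {q} v-w≡δq (ℕP.n<1+n k) (ℕP.≤-<-trans k<y₀ y₀<d))) ⟩
    (q y₀ - q x₀) - sumBetween x₀ y₀ (λ k → q (suc k) - q k)
      ≡⟨ cong (_-_ (q y₀ - q x₀)) (sumBetween-telescope q (ℕP.<⇒≤ i<j)) ⟩
    (q y₀ - q x₀) - (q y₀ - q x₀)
      ≡⟨ ℤP.+-inverseʳ (q y₀ - q x₀) ⟩
    + 0 ∎)
    where
    open ≡-Reasoning
    x₀ y₀ : ℕ
    x₀ = toℕ (tail r)
    y₀ = toℕ (head r)
    y₀<d : y₀ ℕ.< d
    y₀<d = FinP.toℕ<n j

  cost-diff : ∀ v w → cost (btilde bB) v - cost (btilde bB) w ≡ sumTo d (λ k → b k * diff v w k (suc k))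
  cost-diff v w = begin
    cost (btilde bB) v - cost (btilde bB) w
      ≡⟨ cong₂ _-_ (cost-path v) (cost-path w) ⟩
    sumTo d (λ k → b k * lift v k (suc k)) - sumTo d (λ k → b k * lift w k (suc k))
      ≡⟨ sumTo-- d (λ k → b k * lift v k (suc k)) (λ k → b k * lift w k (suc k)) ⟨
    sumTo d (λ k → b k * lift v k (suc k) - b k * lift w k (suc k))
      ≡⟨ sumTo-cong d (λ k _ → distrib (b k) (lift v k (suc k)) (lift w k (suc k))) ⟨
    sumTo d (λ k → b k * diff v w k (suc k)) ∎
    where
    open ≡-Reasoning
    distrib : ∀ a x y → a * (x - y) ≡ a * x - a * y
    distrib = solve-∀

  cost-coboundary : ∀ {v w} q → (∀ a → + v a - + w a ≡ δ q a) →
    cost (btilde bB) v - cost (btilde bB) w ≡ sumTo d (λ k → b k * (q (suc k) - q k))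
  cost-coboundary {v} {w} q v-w≡δq = trans (cost-diff v w) (sumTo-cong d (λ k _ → on-path (suc k ℕ.<? d)))
    where
    on-path : ∀ {k} → Dec (suc k ℕ.< d) → b k * diff v w k (suc k) ≡ b k * (q (suc k) - q k)
    on-path {k} (yes k+1<d) = cong (b k *_) (diff-coboundary {v} {w} {q} v-w≡δq (ℕP.n<1+n k) k+1<d)
    on-path {k} (no k+1≮d) rewrite b-outside {k} (ℕP.≮⇒≥ k+1≮d) =
      trans (ℤP.*-zeroˡ (diff v w k (suc k))) (sym (ℤP.*-zeroˡ (q (suc k) - q k)))

  btilde-nonneg : (∀ t → + 0 ℤ.≤ bB t) → ∀ a → + 0 ℤ.≤ btilde bB a
  btilde-nonneg bB≥0 a with isTreeArc? a
  ... | yes a∈B = bB≥0 (a , a∈B)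
  ... | no _    = ℤP.≤-refl

  b-nonneg : (∃[ x ] (∀ t → mulVec cutsetMatrix x t ≡ bB t)) → ∀ k → + 0 ℤ.≤ b k
  b-nonneg (x , Mx≡bB) k = extend-nonneg (btilde-nonneg bB≥0) k (suc k)
    where
    bB≥0 : ∀ t → + 0 ℤ.≤ bB t
    bB≥0 (t , _) = subst (+ 0 ℤ.≤_) (Mx≡bB _) (sumArcs-nonneg (λ c →
      *-nonneg (subst (+ 0 ℤ.≤_) (sym (cutEntry-between t c)) (⟦⟧-nonneg _)) (ℤ.+≤+ z≤n)))

coTree-not : ∀ {d} (T : Arc d → Bool) a → coTree T a ≡ not (T a)
coTree-not T a with T a
... | true  = refl
... | false = refl

module Separation (d : ℕ) (bB : TreeArc d → ℤ) where

  open ArcPairs d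
  open CostsAndFibres d bB

  Ideal : (Arc d → ℕ) → Set
  Ideal = InInitialIdeal circuitMatrix (btilde bB)

  record Separates (T : Arc d → Bool) (e : Arc d) (q : ℕ → ℤ) : Set where
    field
      rise-on-e   : δ q e ≡ + 1
      fall-on-T   : ∀ a → T a ≡ true → a ≢ e → δ q a ℤ.≤ + 0
      rise-≤1     : ∀ a → δ q a ℤ.≤ + 1
      cost-nonneg : + 0 ℤ.≤ sumTo d (λ k → b k * (q (suc k) - q k))

  -- If e could join co-T in a standard pair, the indicator u of co-T ∪ {e} would be optimal in its
  -- fibre; then u − δq is a second optimum (same fibre, nonnegative, not more expensive) that
  -- differs from u at e, against genericity.
  module SeparatedArc (gen : Generic circuitMatrix (btilde bB)) {T : Arc d → Bool} {e : Arc d} {q : ℕ → ℤ}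
    (e∈T : T e ≡ true) (sep : Separates T e q) {b′ : Arc d → ℕ} {τ : Arc d → Bool}
    (b′+w∉I : ∀ w → (∀ a → τ a ≡ false → w a ≡ 0) → ¬ Ideal (b′ ⊕ w))
    (above : PairLeq zeroVec (coTree T) b′ τ) (τe : τ e ≡ true) where

    open Separates sep

    indicator : Arc d → ℕ
    indicator a = if T a then (if does (a ≟ₐ e) then 1 else 0) else 1

    u : Arc d → ℕ
    u = b′ ⊕ indicator

    u≡indicator : ∀ a → u a ≡ indicator a
    u≡indicator a = cong (ℕ._+ indicator a) (ℕP.n≤0⇒n≡0 (proj₁ above a))

    indicator-inside-τ : ∀ a → τ a ≡ false → indicator a ≡ 0
    indicator-inside-τ a τa≡false = by-cases (T a) refl (a ≟ₐ e)
      where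
      by-cases : ∀ t → T a ≡ t → (a≟e : Dec (a ≡ e)) → (if t then (if does a≟e then 1 else 0) else 1) ≡ 0
      by-cases true  _        (yes refl) = clash τe τa≡false
      by-cases true  _        (no _)     = refl
      by-cases false Ta≡false _          = clash (proj₂ above a (inj₂ (trans (coTree-not T a) (cong not Ta≡false)))) τa≡false

    u-optimal : Optimal circuitMatrix (btilde bB) u
    u-optimal y y~u = ℤP.≮⇒≥ (λ y<u → b′+w∉I indicator indicator-inside-τ (y , y~u , y<u))

    u-δq≥0 : ∀ a → + 0 ℤ.≤ + u a - δ q a
    u-δq≥0 a = subst (λ n → + 0 ℤ.≤ + n - δ q a) (sym (u≡indicator a)) (by-cases (T a) refl (a ≟ₐ e))
      where
      by-cases : ∀ t → T a ≡ t → (a≟e : Dec (a ≡ e)) →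
        + 0 ℤ.≤ + (if t then (if does a≟e then 1 else 0) else 1) - δ q a
      by-cases true  _   (yes refl) = ℤP.≤-reflexive (sym (trans (cong (_-_ (+ 1)) rise-on-e) (ℤP.+-inverseʳ (+ 1))))
      by-cases true  a∈T (no a≢e)   = ℤP.i≤j⇒0≤j-i (fall-on-T a a∈T a≢e)
      by-cases false _   _          = ℤP.i≤j⇒0≤j-i (rise-≤1 a)

    v : Arc d → ℕ
    v a = ℤ.∣ + u a - δ q a ∣

    u-v≡δq : ∀ a → + u a - + v a ≡ δ q a
    u-v≡δq a = trans (cong (_-_ (+ u a)) (ℤP.0≤i⇒+∣i∣≡i (u-δq≥0 a))) (cancel (+ u a) (δ q a))
      where
      cancel : ∀ x y → x - (x - y) ≡ y
      cancel = solve-∀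

    u~v : SameFiber circuitMatrix u v
    u~v = coboundary⇒sameFiber q u-v≡δq

    v-optimal : Optimal circuitMatrix (btilde bB) v
    v-optimal y y~v = ℤP.≤-trans (ℤP.0≤i-j⇒j≤i (subst (+ 0 ℤ.≤_) (sym (cost-coboundary q u-v≡δq)) cost-nonneg))
                                 (u-optimal y (λ r → trans (y~v r) (sym (u~v r))))

    ue≡1 : u e ≡ 1
    ue≡1 = trans (u≡indicator e) (trans (cong (λ t → if t then _ else 1) e∈T) (if-cong (dec-true (e ≟ₐ e) refl)))

    ve≡0 : v e ≡ 0
    ve≡0 = ℤP.+-injective (begin
      + v e          ≡⟨ ℤP.0≤i⇒+∣i∣≡i (u-δq≥0 e) ⟩
      + u e - δ q e  ≡⟨ cong₂ _-_ (cong +_ ue≡1) rise-on-e ⟩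
      + 1 - + 1      ≡⟨ ℤP.+-inverseʳ (+ 1) ⟩
      + 0            ∎)
      where open ≡-Reasoning

    genericity-violated : ⊥
    genericity-violated = ℕP.1+n≢0 (trans (sym ue≡1) (trans (gen u v u~v u-optimal v-optimal e) ve≡0))

  separated-arc-outside : Generic circuitMatrix (btilde bB) → ∀ {T e q} → T e ≡ true → Separates T e q →
    ∀ {b′ τ} → Admissible Ideal b′ τ → PairLeq zeroVec (coTree T) b′ τ → τ e ≡ false
  separated-arc-outside gen e∈T sep (_ , b′+w∉I) above =
    ¬-not (λ τe → SeparatedArc.genericity-violated gen e∈T sep b′+w∉I above τe)

  cut : ℕ → ℕ → ℤ
  cut m y = ⟦ does (m ℕ.<? y) ⟧

  point : ℕ → ℕ → ℤ
  point m y = ⟦ does (y ℕ.≟ m) ⟧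

  sumTo-δpoint : ∀ m → suc m ℕ.< d → sumTo d (λ k → b k * (point (suc m) (suc k) - point (suc m) k)) ≡ b m - b (suc m)
  sumTo-δpoint m m+1<d = begin
    sumTo d (λ k → b k * (point (suc m) (suc k) - point (suc m) k))
      ≡⟨ sumTo-cong d (λ k _ → split k) ⟩
    sumTo d (λ k → at m k - at (suc m) k)
      ≡⟨ sumTo-- d (at m) (at (suc m)) ⟩
    sumTo d (at m) - sumTo d (at (suc m))
      ≡⟨ cong₂ _-_ (sumTo-point d m b) (sumTo-point d (suc m) b) ⟩
    (if does (m ℕ.<? d) then b m else + 0) - (if does (suc m ℕ.<? d) then b (suc m) else + 0)
      ≡⟨ cong₂ _-_ (if-cong (dec-true (m ℕ.<? d) (ℕP.<-trans (ℕP.n<1+n m) m+1<d)))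
                   (if-cong (dec-true (suc m ℕ.<? d) m+1<d)) ⟩
    b m - b (suc m) ∎
    where
    open ≡-Reasoning
    at : ℕ → ℕ → ℤ
    at m k = if does (k ℕ.≟ m) then b k else + 0
    distrib : ∀ x p r → x * (p - r) ≡ p * x - r * x
    distrib = solve-∀
    split : ∀ k → b k * (point (suc m) (suc k) - point (suc m) k) ≡ at m k - at (suc m) k
    split k = trans (distrib (b k) (point (suc m) (suc k)) (point (suc m) k))
                    (cong₂ _-_ (⟦⟧-* (does (k ℕ.≟ m)) (b k)) (⟦⟧-* (does (k ℕ.≟ suc m)) (b k)))

  module _ (b≥0 : ∀ k → + 0 ℤ.≤ b k) {T : Arc d → Bool} {e : Arc d} where

    cut-separates : ∀ m → toℕ (tail e) ℕ.≤ m → m ℕ.< toℕ (head e) →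
      (∀ a → T a ≡ true → toℕ (tail a) ℕ.≤ m → m ℕ.< toℕ (head a) → a ≡ e) → Separates T e (cut m)
    cut-separates m te≤m m<he only-e = record
      { rise-on-e   = cong₂ (λ s t → ⟦ s ⟧ - ⟦ t ⟧) (dec-true (m ℕ.<? _) m<he) (dec-false (m ℕ.<? _) (ℕP.≤⇒≯ te≤m))
      ; fall-on-T   = λ a a∈T a≢e → ⟦⟧-diff-≤0 (m ℕ.<? _) (m ℕ.<? _) (λ m<ha →
                        ℕP.≰⇒> (λ ta≤m → a≢e (only-e a a∈T ta≤m m<ha)))
      ; rise-≤1     = λ a → ⟦⟧-diff-≤1 (does (m ℕ.<? toℕ (head a))) (does (m ℕ.<? toℕ (tail a)))
      ; cost-nonneg = sumTo-nonneg d (λ k _ → *-nonneg (b≥0 k) (⟦⟧-diff-≥0 (m ℕ.<? suc k) (m ℕ.<? k) ℕP.m<n⇒m<1+n))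
      }

    sink-separates : ∀ m → toℕ (head e) ≡ suc m → (∀ a → T a ≡ true → toℕ (head a) ≡ suc m → a ≡ e) →
      b (suc m) ℤ.≤ b m → Separates T e (point (suc m))
    sink-separates m he≡1+m only-e b[m+1]≤b[m] = record
      { rise-on-e   = cong₂ (λ s t → ⟦ s ⟧ - ⟦ t ⟧) (dec-true (_ ℕ.≟ suc m) he≡1+m)
                            (dec-false (_ ℕ.≟ suc m) (λ te≡1+m → ℕP.<-irrefl (trans te≡1+m (sym he≡1+m)) (proj₂ (proj₂ e))))
      ; fall-on-T   = λ a a∈T a≢e → ⟦⟧-diff-≤0 (toℕ (head a) ℕ.≟ suc m) (toℕ (tail a) ℕ.≟ suc m)
                        (λ ha≡1+m → contradiction (only-e a a∈T ha≡1+m) a≢e)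
      ; rise-≤1     = λ a → ⟦⟧-diff-≤1 (does (toℕ (head a) ℕ.≟ suc m)) (does (toℕ (tail a) ℕ.≟ suc m))
      ; cost-nonneg = subst (+ 0 ℤ.≤_) (sym (sumTo-δpoint m (subst (ℕ._< d) he≡1+m (FinP.toℕ<n (head e)))))
                            (ℤP.i≤j⇒0≤j-i b[m+1]≤b[m])
      }

    source-separates : ∀ m → toℕ (tail e) ≡ suc m → (∀ a → T a ≡ true → toℕ (tail a) ≡ suc m → a ≡ e) →
      b m ℤ.≤ b (suc m) → Separates T e (λ y → - point (suc m) y)
    source-separates m te≡1+m only-e b[m]≤b[m+1] = record
      { rise-on-e   = trans (flip (point (suc m) (toℕ (head e))) (point (suc m) (toℕ (tail e))))
                            (cong₂ (λ s t → ⟦ s ⟧ - ⟦ t ⟧) (dec-true (_ ℕ.≟ suc m) te≡1+m)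
                               (dec-false (_ ℕ.≟ suc m) (λ he≡1+m → ℕP.<-irrefl (trans te≡1+m (sym he≡1+m)) (proj₂ (proj₂ e)))))
      ; fall-on-T   = λ a a∈T a≢e → subst (ℤ._≤ + 0) (sym (flip (point (suc m) (toℕ (head a))) (point (suc m) (toℕ (tail a)))))
                        (⟦⟧-diff-≤0 (toℕ (tail a) ℕ.≟ suc m) (toℕ (head a) ℕ.≟ suc m)
                           (λ ta≡1+m → contradiction (only-e a a∈T ta≡1+m) a≢e))
      ; rise-≤1     = λ a → subst (ℤ._≤ + 1) (sym (flip (point (suc m) (toℕ (head a))) (point (suc m) (toℕ (tail a)))))
                        (⟦⟧-diff-≤1 (does (toℕ (tail a) ℕ.≟ suc m)) (does (toℕ (head a) ℕ.≟ suc m)))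
      ; cost-nonneg = subst (+ 0 ℤ.≤_) (sym cost-sum) (ℤP.i≤j⇒0≤j-i b[m]≤b[m+1])
      }
      where
      open ≡-Reasoning
      flip : ∀ x y → - x - - y ≡ y - x
      flip = solve-∀
      distrib : ∀ c x y → c * (- x - - y) ≡ - (c * (x - y))
      distrib = solve-∀
      negate : ∀ x y → - (x - y) ≡ y - x
      negate = solve-∀
      m+1<d : suc m ℕ.< d
      m+1<d = ℕP.<-trans (subst (ℕ._< toℕ (head e)) te≡1+m (proj₂ (proj₂ e))) (FinP.toℕ<n (head e))
      cost-sum : sumTo d (λ k → b k * (- point (suc m) (suc k) - - point (suc m) k)) ≡ b (suc m) - b m
      cost-sum = begin
        sumTo d (λ k → b k * (- point (suc m) (suc k) - - point (suc m) k))
          ≡⟨ sumTo-cong d (λ k _ → distrib (b k) (point (suc m) (suc k)) (point (suc m) k)) ⟩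
        sumTo d (λ k → - (b k * (point (suc m) (suc k) - point (suc m) k)))
          ≡⟨ sumTo-neg d (λ k → b k * (point (suc m) (suc k) - point (suc m) k)) ⟩
        - sumTo d (λ k → b k * (point (suc m) (suc k) - point (suc m) k))
          ≡⟨ cong -_ (sumTo-δpoint m m+1<d) ⟩
        - (b m - b (suc m))
          ≡⟨ negate (b m) (b (suc m)) ⟩
        b (suc m) - b m ∎

cycle-irreflexive : ∀ {V : Set} {P : V → V → Set} → (∀ {x y z} → P x y → P y z → P x z) → (∀ {x} → ¬ P x x) →
  ∀ v xs → ¬ Linked P (v ∷ xs ++ v ∷ [])
cycle-irreflexive trans irrefl v []       (Pvv ∷ _)      = irrefl Pvv
cycle-irreflexive trans irrefl v (x ∷ xs) (Pvx ∷ chain) with ++⁻ʳ (x ∷ xs) (Linked⇒All trans Pvx chain)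
... | Pvv ∷ [] = irrefl Pvv

module RankedForest {V : Set} (R : V → V → Set) (R-sym : ∀ {x y} → R x y → R y x) (rank : V → ℕ)
  (rank-≢ : ∀ {x y} → R x y → rank x ≢ rank y)
  (lower-unique : ∀ {x y y′} → R x y → R x y′ → rank y ℕ.< rank x → rank y′ ℕ.< rank x → y ≡ y′) where

  NonBacktracking : List V → Set
  NonBacktracking (x ∷ y ∷ z ∷ zs) = x ≢ z × NonBacktracking (y ∷ z ∷ zs)
  NonBacktracking _                = ⊤

  Rising Falling : List V → Set
  Rising  = Linked (λ x y → rank x ℕ.< rank y)
  Falling = Linked (λ x y → rank y ℕ.< rank x)

  lastOf : V → List V → V
  lastOf x []       = x
  lastOf x (y ∷ ys) = lastOf y ys

  lastStep : V → V → List V → V × V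
  lastStep x y []       = x , y
  lastStep x y (z ∷ zs) = lastStep y z zs

  rising-persists : ∀ {x y ys} → NonBacktracking (x ∷ y ∷ ys) → Linked R (x ∷ y ∷ ys) →
    rank x ℕ.< rank y → Rising (x ∷ y ∷ ys)
  rising-persists {ys = []}     _          _                  x<y = x<y ∷ [-]
  rising-persists {ys = z ∷ zs} (x≢z , nb) (xRy ∷ yRz ∷ walk) x<y =
    x<y ∷ rising-persists nb (yRz ∷ walk) (ℕP.≤∧≢⇒< (ℕP.≮⇒≥ z≮y) (rank-≢ yRz))
    where
    z≮y : ¬ rank z ℕ.< rank _
    z≮y z<y = x≢z (lower-unique (R-sym xRy) yRz x<y z<y)

  rising-lastStep : ∀ {x y ys} → Rising (x ∷ y ∷ ys) → rank (proj₁ (lastStep x y ys)) ℕ.< rank (proj₂ (lastStep x y ys))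
  rising-lastStep {ys = []}     (x<y ∷ _)    = x<y
  rising-lastStep {ys = _ ∷ _}  (_ ∷ rising) = rising-lastStep rising

  falling-or-rising-end : ∀ {x y ys} → NonBacktracking (x ∷ y ∷ ys) → Linked R (x ∷ y ∷ ys) →
    Falling (x ∷ y ∷ ys) ⊎ rank (proj₁ (lastStep x y ys)) ℕ.< rank (proj₂ (lastStep x y ys))
  falling-or-rising-end {x} {y} {ys} nb walk@(xRy ∷ _) with ℕP.<-cmp (rank x) (rank y)
  ... | tri< x<y _ _ = inj₂ (rising-lastStep (rising-persists nb walk x<y))
  ... | tri≈ _ x≡y _ = contradiction x≡y (rank-≢ xRy)
  falling-or-rising-end {ys = []}     _        _               | tri> _ _ y<x = inj₁ (y<x ∷ [-])
  falling-or-rising-end {ys = _ ∷ _}  (_ , nb) (_ ∷ walk)      | tri> _ _ y<x with falling-or-rising-end nb walk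
  ... | inj₁ falling = inj₁ (y<x ∷ falling)
  ... | inj₂ rises   = inj₂ rises

  lastStep-edge : ∀ {x y ys} → Linked R (x ∷ y ∷ ys) → R (proj₁ (lastStep x y ys)) (proj₂ (lastStep x y ys))
  lastStep-edge {ys = []}    (xRy ∷ _) = xRy
  lastStep-edge {ys = _ ∷ _} (_ ∷ walk) = lastStep-edge walk

  lastStep-snoc : ∀ x y ys z → lastStep x y (ys ++ z ∷ []) ≡ (lastOf y ys , z)
  lastStep-snoc x y []       z = refl
  lastStep-snoc x y (w ∷ ws) z = lastStep-snoc y w ws z

  lastOf-∉ : ∀ {v} x xs → All (v ≢_) (x ∷ xs) → v ≢ lastOf x xs
  lastOf-∉ x []       (v≢x ∷ _)  = v≢x
  lastOf-∉ x (y ∷ ys) (_ ∷ v∉ys) = lastOf-∉ y ys v∉ys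

  unique-nonBacktracking : ∀ {y} x xs → Unique (x ∷ xs) → All (_≢ y) (x ∷ xs) → NonBacktracking (x ∷ xs ++ y ∷ [])
  unique-nonBacktracking x []            _                        _              = tt
  unique-nonBacktracking x (x₁ ∷ [])     _                        (x≢y ∷ _)      = x≢y , tt
  unique-nonBacktracking x (x₁ ∷ x₂ ∷ xs) ((_ ∷ x≢x₂ ∷ _) ∷ unique) (_ ∷ ≢y)     =
    x≢x₂ , unique-nonBacktracking x₁ (x₂ ∷ xs) unique ≢y

  -- A closed walk through v neither falls nor rises all the way round, so its first step falls and its
  -- last step rises: v would have the two lower neighbours w₁ ≠ wₘ.
  acyclic : ∀ v ws → 2 ℕ.≤ length ws → Unique (v ∷ ws) → ¬ Linked R (v ∷ ws ++ v ∷ [])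
  acyclic v (_ ∷ [])       (s≤s ())
  acyclic v (w₁ ∷ w₂ ∷ ws) _ ((v≢w₁ ∷ v≢w₂ ∷ v∉ws) ∷ unique@(w₁∉ws ∷ _)) =
    no-closed-walk (v≢w₂ , unique-nonBacktracking w₁ (w₂ ∷ ws) unique
                              (All.map (λ v≢z z≡v → v≢z (sym z≡v)) (v≢w₁ ∷ v≢w₂ ∷ v∉ws)))
    where
    no-closed-walk : NonBacktracking (v ∷ w₁ ∷ w₂ ∷ ws ++ v ∷ []) → ¬ Linked R (v ∷ w₁ ∷ w₂ ∷ ws ++ v ∷ [])
    no-closed-walk nb walk@(vRw₁ ∷ _) with falling-or-rising-end nb walk
    ... | inj₁ falling = cycle-irreflexive (λ z<y y<x → ℕP.<-trans y<x z<y) (ℕP.<-irrefl refl) v (w₁ ∷ w₂ ∷ ws) falling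
    ... | inj₂ rises with ℕP.<-cmp (rank v) (rank w₁)
    ...   | tri< v<w₁ _ _ = cycle-irreflexive ℕP.<-trans (ℕP.<-irrefl refl) v (w₁ ∷ w₂ ∷ ws) (rising-persists nb walk v<w₁)
    ...   | tri≈ _ v≡w₁ _ = rank-≢ vRw₁ v≡w₁
    ...   | tri> _ _ w₁<v = lastOf-∉ w₂ ws w₁∉ws (lower-unique vRw₁ (R-sym last-edge) w₁<v last-rises)
      where
      last-rises : rank (lastOf w₂ ws) ℕ.< rank v
      last-rises = subst (λ p → rank (proj₁ p) ℕ.< rank (proj₂ p)) (lastStep-snoc w₁ w₂ ws v) rises
      last-edge : R (lastOf w₂ ws) v
      last-edge = subst (λ p → R (proj₁ p) (proj₂ p)) (lastStep-snoc w₁ w₂ ws v) (lastStep-edge walk)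

record Sparse (d : ℕ) (σ : ℕ → Bool) : Set where
  field
    positive : ∀ {t} → σ t ≡ true → 1 ℕ.≤ t
    room     : ∀ {t} → σ t ≡ true → 2 ℕ.+ t ℕ.< d
    apart    : ∀ {t t′} → σ t ≡ true → σ t′ ≡ true → t ℕ.< t′ → 3 ℕ.+ t ℕ.≤ t′

bypass-cases : ∀ a b c e → (a ∧ b) ∨ (c ∧ not e) ≡ true → (a ≡ true × b ≡ true) ⊎ (c ≡ true × e ≡ false)
bypass-cases true  true  _     _     _ = inj₁ (refl , refl)
bypass-cases true  false true  false _ = inj₂ (refl , refl)
bypass-cases false _     true  false _ = inj₂ (refl , refl)

between-one : ∀ {t m} → t ℕ.≤ m → m ℕ.< suc t → t ≡ m
between-one t≤m m<t+1 = ℕP.≤-antisym t≤m (ℕP.≤-pred m<t+1)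

between-two : ∀ {t m} → t ℕ.≤ m → m ℕ.< 2 ℕ.+ t → t ≡ m ⊎ suc t ≡ m
between-two {t} {m} t≤m m<t+2 with ℕP.m≤n⇒m<n∨m≡n t≤m
... | inj₁ t<m = inj₂ (between-one t<m m<t+2)
... | inj₂ t≡m = inj₁ t≡m

module Bypass {d : ℕ} {σ : ℕ → Bool} (sparse : Sparse d σ) (left : ℕ → Bool) where

  open Sparse sparse
  open ArcPairs d

  σ-near : ∀ {t t′} → σ t ≡ true → t ℕ.< t′ → t′ ℕ.< 3 ℕ.+ t → σ t′ ≡ false
  σ-near σt t<t′ t′<t+3 = ¬-not (λ σt′ → ℕP.<⇒≱ t′<t+3 (apart σt σt′ t<t′))

  σ-suc : ∀ {t} → σ t ≡ true → σ (suc t) ≡ false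
  σ-suc σt = σ-near σt (ℕP.n<1+n _) (s≤s (s≤s (ℕP.n≤1+n _)))

  σ-suc² : ∀ {t} → σ t ≡ true → σ (2 ℕ.+ t) ≡ false
  σ-suc² σt = σ-near σt (ℕP.m<n+m _ (s≤s z≤n)) ℕP.≤-refl

  σ-pred : ∀ {t} → σ (suc t) ≡ true → σ t ≡ false
  σ-pred σt+1 = ¬-not (λ σt → contradiction (trans (sym σt+1) (σ-suc σt)) λ ())

  bypassˡ bypassʳ jump : ℕ → Bool
  bypassˡ x = σ (suc x) ∧ left (suc x)
  bypassʳ x = σ x ∧ not (left x)
  jump x = bypassˡ x ∨ bypassʳ x

  inTree : ℕ → ℕ → Bool
  inTree x y = if does (y ℕ.≟ suc x) then not (σ x) else (if does (y ℕ.≟ 2 ℕ.+ x) then jump x else false)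

  data TreePair : ℕ → ℕ → Set where
    path         : ∀ {x} → σ x ≡ false → TreePair x (suc x)
    bypass-left  : ∀ {x} → σ (suc x) ≡ true → left (suc x) ≡ true → TreePair x (2 ℕ.+ x)
    bypass-right : ∀ {x} → σ x ≡ true → left x ≡ false → TreePair x (2 ℕ.+ x)

  inTree-path : ∀ x → inTree x (suc x) ≡ not (σ x)
  inTree-path x = if-cong (dec-true (suc x ℕ.≟ suc x) refl)

  inTree-jump : ∀ x → inTree x (2 ℕ.+ x) ≡ jump x
  inTree-jump x =
    trans (if-cong (dec-false (2 ℕ.+ x ℕ.≟ suc x) ℕP.1+n≢n)) (if-cong (dec-true (2 ℕ.+ x ℕ.≟ 2 ℕ.+ x) refl))

  treePair : ∀ {x y} → inTree x y ≡ true → TreePair x y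
  treePair {x} {y} = by-cases (y ℕ.≟ suc x) (y ℕ.≟ 2 ℕ.+ x)
    where
    by-cases : (y≟x+1 : Dec (y ≡ suc x)) (y≟x+2 : Dec (y ≡ 2 ℕ.+ x)) →
      (if does y≟x+1 then not (σ x) else (if does y≟x+2 then jump x else false)) ≡ true → TreePair x y
    by-cases (yes refl) _          not-σx = path (¬-not (λ σx → contradiction (trans (sym not-σx) (cong not σx)) λ ()))
    by-cases (no _)     (yes refl) jx with bypass-cases (σ (suc x)) (left (suc x)) (σ x) (left x) jx
    ... | inj₁ (σx+1 , lx+1) = bypass-left σx+1 lx+1
    ... | inj₂ (σx , ¬lx)    = bypass-right σx ¬lx

  fromTreePair : ∀ {x y} → TreePair x y → inTree x y ≡ true
  fromTreePair {x} (path σx)             = trans (inTree-path x) (cong not σx)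
  fromTreePair {x} (bypass-left σx+1 lx+1) =
    trans (inTree-jump x) (cong₂ (λ s t → (s ∧ t) ∨ (σ x ∧ not (left x))) σx+1 lx+1)
  fromTreePair {x} (bypass-right σx ¬lx) =
    trans (inTree-jump x) (trans (cong₂ (λ s t → (σ (suc x) ∧ left (suc x)) ∨ (s ∧ not t)) σx ¬lx) (∨-zeroʳ _))

  treePair-< : ∀ {x y} → TreePair x y → x ℕ.< y
  treePair-< (path _)           = ℕP.n<1+n _
  treePair-< (bypass-left _ _)  = ℕP.m<n+m _ (s≤s z≤n)
  treePair-< (bypass-right _ _) = ℕP.m<n+m _ (s≤s z≤n)

  T : Arc d → Bool
  T a = inTree (toℕ (tail a)) (toℕ (head a))

  T-path : ∀ {k} a → toℕ (tail a) ≡ k → toℕ (head a) ≡ suc k → T a ≡ not (σ k)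
  T-path {k} a t≡k h≡k+1 = trans (cong₂ inTree t≡k h≡k+1) (inTree-path k)

  Adj : Fin d → Fin d → Set
  Adj = Adjacent T

  adj-sym : ∀ {u v} → Adj u v → Adj v u
  adj-sym (a , a∈T , inj₁ ends) = a , a∈T , inj₂ ends
  adj-sym (a , a∈T , inj₂ ends) = a , a∈T , inj₁ ends

  adj-pair : ∀ {u v} → Adj u v → TreePair (toℕ u) (toℕ v) ⊎ TreePair (toℕ v) (toℕ u)
  adj-pair (_ , a∈T , inj₁ (refl , refl)) = inj₁ (treePair a∈T)
  adj-pair (_ , a∈T , inj₂ (refl , refl)) = inj₂ (treePair a∈T)

  pair-adj : ∀ {x y} (p : TreePair x y) (y<d : y ℕ.< d) →
    Adj (Fin.fromℕ< (ℕP.<-trans (treePair-< p) y<d)) (Fin.fromℕ< y<d)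
  pair-adj p y<d = arc (treePair-< p) y<d ,
    subst₂ (λ s t → inTree s t ≡ true) (sym (tail-arc (treePair-< p) y<d)) (sym (head-arc (treePair-< p) y<d)) (fromTreePair p) ,
    inj₁ (refl , refl)

  from-root : ∀ x (x<d : x ℕ.< d) → Star Adj (Fin.fromℕ< (ℕP.≤-<-trans z≤n x<d)) (Fin.fromℕ< x<d)
  from-root zero    _     = ε
  from-root (suc x) x+1<d with σ x in σx | left x in lx
  ... | false | _     = from-root x (ℕP.<-trans (ℕP.n<1+n x) x+1<d) ◅◅ return (pair-adj (path σx) x+1<d)
  ... | true  | false = from-root x (ℕP.<-trans (ℕP.n<1+n x) x+1<d) ◅◅
                          (pair-adj (bypass-right σx lx) (room σx) ◅ return (adj-sym (pair-adj (path (σ-suc σx)) (room σx))))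
  from-root (suc zero)    _     | true | true = contradiction (positive σx) λ ()
  from-root (suc (suc x)) x+2<d | true | true =
    from-root x (ℕP.<-trans (ℕP.m<n+m x (s≤s z≤n)) x+2<d) ◅◅ return (pair-adj (bypass-left σx lx) x+2<d)

  connected : Connected T
  connected u v = Star.reverse adj-sym (from-root′ u) ◅◅ from-root′ v
    where
    from-root′ : ∀ w → Star Adj (Fin.fromℕ< (ℕP.≤-<-trans z≤n (FinP.toℕ<n w))) w
    from-root′ w = subst (Star Adj _) (FinP.fromℕ<-toℕ w (FinP.toℕ<n w)) (from-root (toℕ w) (FinP.toℕ<n w))

  -- from-root reaches the vertices in the order of rank: t + 1 comes after t + 2 when t ∈ σ is
  -- bypassed on the right.  Every vertex other than 0 then has exactly one neighbour of lower rank.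
  detour : ℕ → Bool
  detour zero    = false
  detour (suc t) = bypassʳ t

  rank : ℕ → ℕ
  rank x = if detour x then 3 ℕ.+ (x ℕ.+ x) else x ℕ.+ x

  rank-detour : ∀ x → detour x ≡ true → rank x ≡ 3 ℕ.+ (x ℕ.+ x)
  rank-detour _ = if-cong

  rank-direct : ∀ x → detour x ≡ false → rank x ≡ x ℕ.+ x
  rank-direct _ = if-cong

  rank-≥ : ∀ x → x ℕ.+ x ℕ.≤ rank x
  rank-≥ x with detour x
  ... | true  = ℕP.m≤n+m _ 3
  ... | false = ℕP.≤-refl

  rank-≤ : ∀ x → rank x ℕ.≤ 3 ℕ.+ (x ℕ.+ x)
  rank-≤ x with detour x
  ... | true  = ℕP.≤-refl
  ... | false = ℕP.m≤n+m _ 3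

  rank-path : ∀ {x} → σ x ≡ false → rank (suc x) ≡ 2 ℕ.+ (x ℕ.+ x)
  rank-path {x} σx = trans (rank-direct (suc x) (cong (_∧ not (left x)) σx)) (cong suc (ℕP.+-suc x x))

  rank-jump : ∀ x → rank x ℕ.< rank (2 ℕ.+ x)
  rank-jump x =
    ℕP.≤-<-trans (rank-≤ x) (ℕP.<-≤-trans (ℕP.n<1+n _) (subst (ℕ._≤ rank (2 ℕ.+ x)) double (rank-≥ (2 ℕ.+ x))))
    where
    double : (2 ℕ.+ x) ℕ.+ (2 ℕ.+ x) ≡ 4 ℕ.+ (x ℕ.+ x)
    double = cong (2 ℕ.+_) (trans (ℕP.+-suc x (suc x)) (cong suc (ℕP.+-suc x x)))

  treePair-rank-≢ : ∀ {x y} → TreePair x y → rank x ≢ rank y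
  treePair-rank-≢ {x} (path σx) rx≡rx+1 with detour x
  ... | true  = ℕP.1+n≢n (trans rx≡rx+1 (rank-path σx))
  ... | false = ℕP.<⇒≢ (ℕP.m<n+m (x ℕ.+ x) {2} (s≤s z≤n)) (trans rx≡rx+1 (rank-path σx))
  treePair-rank-≢ {x} (bypass-left _ _)  = ℕP.<⇒≢ (rank-jump x)
  treePair-rank-≢ {x} (bypass-right _ _) = ℕP.<⇒≢ (rank-jump x)

  parent : ℕ → ℕ
  parent x = if detour x then suc x else (if not (σ (x ∸ 1)) ∧ not (detour (x ∸ 1)) then x ∸ 1 else x ∸ 2)

  lower-is-parent : ∀ {x y} → TreePair x y ⊎ TreePair y x → rank y ℕ.< rank x → y ≡ parent x
  lower-is-parent {x} (inj₁ (path σx)) r[x+1]<r[x] = by-cases (detour x) refl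
    where
    by-cases : ∀ c → detour x ≡ c → suc x ≡ parent x
    by-cases true  dx = sym (if-cong dx)
    by-cases false dx = contradiction (subst₂ ℕ._<_ (rank-path σx) (rank-direct x dx) r[x+1]<r[x])
                                      (ℕP.<⇒≯ (ℕP.m<n+m (x ℕ.+ x) {2} (s≤s z≤n)))
  lower-is-parent {x} (inj₁ (bypass-left _ _))  r[x+2]<r[x] = contradiction r[x+2]<r[x] (ℕP.<⇒≯ (rank-jump x))
  lower-is-parent {x} (inj₁ (bypass-right _ _)) r[x+2]<r[x] = contradiction r[x+2]<r[x] (ℕP.<⇒≯ (rank-jump x))
  lower-is-parent (inj₂ (path {y} σy)) r[y]<r[y+1] = by-cases (detour y) refl
    where
    by-cases : ∀ c → detour y ≡ c → y ≡ parent (suc y)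
    by-cases true  dy = contradiction (subst₂ ℕ._<_ (rank-detour y dy) (rank-path σy) r[y]<r[y+1]) (ℕP.<⇒≯ (ℕP.n<1+n _))
    by-cases false dy = sym (trans (if-cong (cong (_∧ not (left y)) σy)) (if-cong (cong₂ (λ s t → not s ∧ not t) σy dy)))
  lower-is-parent (inj₂ (bypass-left {y} σy+1 ly+1)) _ =
    sym (trans (if-cong (cong₂ (λ s t → s ∧ not t) σy+1 ly+1)) (if-cong (cong (λ s → not s ∧ not (detour (suc y))) σy+1)))
  lower-is-parent (inj₂ (bypass-right {y} σy ¬ly)) _ =
    sym (trans (if-cong (cong (_∧ not (left (suc y))) (σ-suc σy)))
               (if-cong (trans (cong₂ (λ s t → not (σ (suc y)) ∧ not (s ∧ not t)) σy ¬ly) (∧-zeroʳ _))))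

  spanning : SpanningTree T
  spanning = connected , RankedForest.acyclic Adj adj-sym (λ v → rank (toℕ v)) rank-≢ lower-unique
    where
    rank-≢ : ∀ {u v} → Adj u v → rank (toℕ u) ≢ rank (toℕ v)
    rank-≢ u~v with adj-pair u~v
    ... | inj₁ p = treePair-rank-≢ p
    ... | inj₂ p = λ eq → treePair-rank-≢ p (sym eq)
    lower-unique : ∀ {u v v′} → Adj u v → Adj u v′ →
      rank (toℕ v) ℕ.< rank (toℕ u) → rank (toℕ v′) ℕ.< rank (toℕ u) → v ≡ v′
    lower-unique u~v u~v′ v<u v′<u =
      FinP.toℕ-injective (trans (lower-is-parent (adj-pair u~v) v<u) (sym (lower-is-parent (adj-pair u~v′) v′<u)))

  path-cut : ∀ {x} → σ x ≡ false → bypassˡ x ≡ false → detour x ≡ false →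
    ∀ {x′ y′} → TreePair x′ y′ → x′ ℕ.≤ x → x ℕ.< y′ → x′ ≡ x × y′ ≡ suc x
  path-cut _  _ _ (path _) x′≤x x<x′+1 with between-one x′≤x x<x′+1
  ... | refl = refl , refl
  path-cut σx A _ (bypass-left σ′ l′) x′≤x x<x′+2 with between-two x′≤x x<x′+2
  ... | inj₁ refl = clash (cong₂ _∧_ σ′ l′) A
  ... | inj₂ refl = clash σ′ σx
  path-cut σx _ B (bypass-right σ′ ¬l′) x′≤x x<x′+2 with between-two x′≤x x<x′+2
  ... | inj₁ refl = clash σ′ σx
  ... | inj₂ refl = clash (cong₂ (λ s l → s ∧ not l) σ′ ¬l′) B

  path-sink : ∀ {x} → σ x ≡ false → bypassˡ x ≡ true →
    ∀ {x′ y′} → TreePair x′ y′ → y′ ≡ suc x → x′ ≡ x × y′ ≡ suc x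
  path-sink _  _ (path _)            refl = refl , refl
  path-sink σx _ (bypass-left σ′ _)  refl = clash σ′ σx
  path-sink _  A (bypass-right σ′ _) refl = clash (∧-conicalˡ _ _ A) (σ-suc² σ′)

  path-source : ∀ {x} → σ (suc x) ≡ false → bypassˡ (suc x) ≡ false →
    ∀ {x′ y′} → TreePair x′ y′ → x′ ≡ suc x → x′ ≡ suc x × y′ ≡ 2 ℕ.+ x
  path-source _  _ (path _)             refl = refl , refl
  path-source _  A (bypass-left σ′ l′)  refl = clash (cong₂ _∧_ σ′ l′) A
  path-source σx _ (bypass-right σ′ _)  refl = clash σ′ σx

  bypassˡ-cut : ∀ {x} → σ (suc x) ≡ true → left (suc x) ≡ true →
    ∀ {x′ y′} → TreePair x′ y′ → x′ ℕ.≤ suc x → suc x ℕ.< y′ → x′ ≡ x × y′ ≡ 2 ℕ.+ x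
  bypassˡ-cut σx+1 _ (path σ′) x′≤x+1 x+1<x′+1 with between-one x′≤x+1 x+1<x′+1
  ... | refl = clash σx+1 σ′
  bypassˡ-cut σx+1 _ (bypass-left σ′ _) x′≤x+1 x+1<x′+2 with between-two x′≤x+1 x+1<x′+2
  ... | inj₁ refl = clash σ′ (σ-suc σx+1)
  ... | inj₂ refl = refl , refl
  bypassˡ-cut σx+1 lx+1 (bypass-right σ′ ¬l′) x′≤x+1 x+1<x′+2 with between-two x′≤x+1 x+1<x′+2
  ... | inj₁ refl = clash lx+1 ¬l′
  ... | inj₂ refl = clash σx+1 (σ-suc σ′)

  bypassʳ-cut : ∀ {x} → σ x ≡ true → left x ≡ false →
    ∀ {x′ y′} → TreePair x′ y′ → x′ ℕ.≤ x → x ℕ.< y′ → x′ ≡ x × y′ ≡ 2 ℕ.+ x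
  bypassʳ-cut σx _ (path σ′) x′≤x x<x′+1 with between-one x′≤x x<x′+1
  ... | refl = clash σx σ′
  bypassʳ-cut σx ¬lx (bypass-left σ′ l′) x′≤x x<x′+2 with between-two x′≤x x<x′+2
  ... | inj₁ refl = clash σ′ (σ-suc σx)
  ... | inj₂ refl = clash l′ ¬lx
  bypassʳ-cut σx _ (bypass-right σ′ _) x′≤x x<x′+2 with between-two x′≤x x<x′+2
  ... | inj₁ refl = refl , refl
  ... | inj₂ refl = clash σx (σ-suc σ′)

minus-weights-nonneg : ∀ {β} α γ {β₁ β₂} → + 0 ℤ.≤ β → (α ≡ true → β₁ ℤ.≤ β) → (γ ≡ true → β₂ ℤ.≤ β) →
  ¬ (α ≡ true × γ ≡ true) → + 0 ℤ.≤ β - (weight α β₁ + + 0) - (+ 0 + weight γ β₂)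
minus-weights-nonneg true  true  _   _     _     excl = contradiction (refl , refl) excl
minus-weights-nonneg {β} true  false {β₁} _ β₁≤β _ _ =
  subst (+ 0 ℤ.≤_) (simplify β β₁) (ℤP.i≤j⇒0≤j-i (β₁≤β refl))
  where
  simplify : ∀ x y → x - y ≡ x - (y + + 0) - (+ 0 + + 0)
  simplify = solve-∀
minus-weights-nonneg {β} false true {β₂ = β₂} _ _ β₂≤β _ =
  subst (+ 0 ℤ.≤_) (simplify β β₂) (ℤP.i≤j⇒0≤j-i (β₂≤β refl))
  where
  simplify : ∀ x y → x - y ≡ x - (+ 0 + + 0) - (+ 0 + y)
  simplify = solve-∀
minus-weights-nonneg {β} false false β≥0 _ _ _ = subst (+ 0 ℤ.≤_) (simplify β) β≥0
  where
  simplify : ∀ x → x ≡ x - (+ 0 + + 0) - (+ 0 + + 0)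
  simplify = solve-∀

module BypassStandardPair {d : ℕ} (bB : TreeArc d → ℤ) (gen : Generic circuitMatrix (btilde bB))
  {σ : ℕ → Bool} (sparse : Sparse d σ) (left : ℕ → Bool)
  (b≥0 : ∀ k → + 0 ℤ.≤ CostsAndFibres.b d bB k)
  (left-ok : ∀ {t} → σ t ≡ true → left t ≡ true → CostsAndFibres.b d bB t ℤ.≤ CostsAndFibres.b d bB (t ∸ 1))
  (right-ok : ∀ {t} → σ t ≡ true → left t ≡ false → CostsAndFibres.b d bB t ℤ.≤ CostsAndFibres.b d bB (suc t)) where

  open ArcPairs d
  open CostsAndFibres d bB
  open Separation d bB
  open Bypass sparse left
  open Sparse sparse

  -- The cost b t of a removed arc moves to its bypass, which also runs over a neighbouring path arc
  -- of cost at least b t; hence what remains on the path arcs, pathWeight, stays nonnegative.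
  bypassWeight : ℕ → ℤ
  bypassWeight x = weight (bypassˡ x) (b (suc x)) + weight (bypassʳ x) (b x)

  pathWeight : ℕ → ℤ
  pathWeight x = b x - bypassWeight x - shift bypassWeight x

  pathWeight-zero : ∀ {x} → σ x ≡ true → pathWeight x ≡ + 0
  pathWeight-zero {zero}  σ0 = contradiction (positive σ0) λ ()
  pathWeight-zero {suc x} σx = begin
    pathWeight (suc x)                       ≡⟨ cong (λ s → shape (σ (2 ℕ.+ x)) s (σ x)) σx ⟩
    shape (σ (2 ℕ.+ x)) true (σ x)  ≡⟨ cong₂ (λ s₂ s₀ → shape s₂ true s₀) (σ-suc σx) (σ-pred σx) ⟩
    shape false true false          ≡⟨ cancel (left (suc x)) ⟩
    + 0                             ∎
    where
    open ≡-Reasoning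
    β : ℤ
    β = b (suc x)
    shape : Bool → Bool → Bool → ℤ
    shape s₂ s₁ s₀ = β - (weight (s₂ ∧ left (2 ℕ.+ x)) (b (2 ℕ.+ x)) + weight (s₁ ∧ not (left (suc x))) β)
                       - (weight (s₁ ∧ left (suc x)) β + weight (s₀ ∧ not (left x)) (b x))
    cancel : ∀ l → β - (+ 0 + weight (not l) β) - (weight l β + + 0) ≡ + 0
    cancel true  = solve′ β
      where
      solve′ : ∀ z → z - (+ 0 + + 0) - (z + + 0) ≡ + 0
      solve′ = solve-∀
    cancel false = solve′ β
      where
      solve′ : ∀ z → z - (+ 0 + z) - (+ 0 + + 0) ≡ + 0
      solve′ = solve-∀

  pathWeight-nonneg : ∀ {x} → σ x ≡ false → + 0 ℤ.≤ pathWeight x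
  pathWeight-nonneg {zero} σ0 = subst (λ s → + 0 ℤ.≤ b 0 - (weight (bypassˡ 0) (b 1) + weight (s ∧ not (left 0)) (b 0)) - + 0)
    (sym σ0) (minus-weights-nonneg (bypassˡ 0) false {β₂ = + 0} (b≥0 0)
               (λ A → left-ok (∧-conicalˡ _ _ A) (∧-conicalʳ _ _ A)) (λ ()) (λ { (_ , ()) }))
  pathWeight-nonneg {suc x} σx = subst (λ s → + 0 ℤ.≤ shape s) (sym σx)
    (minus-weights-nonneg (bypassˡ (suc x)) (bypassʳ x) (b≥0 (suc x))
      (λ A → left-ok (∧-conicalˡ _ _ A) (∧-conicalʳ _ _ A))
      (λ B → right-ok (∧-conicalˡ _ _ B) (not-true (∧-conicalʳ _ _ B)))
      (λ (A , B) → clash (∧-conicalˡ _ _ A) (σ-suc² (∧-conicalˡ _ _ B))))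
    where
    shape : Bool → ℤ
    shape s = b (suc x) - (weight (bypassˡ (suc x)) (b (2 ℕ.+ x)) + weight (s ∧ not (left (suc x))) (b (suc x)))
                        - (weight (s ∧ left (suc x)) (b (suc x)) + weight (bypassʳ x) (b x))

  bypassWeight-nonneg : ∀ x → + 0 ℤ.≤ bypassWeight x
  bypassWeight-nonneg x = ℤP.+-mono-≤ (weight-nonneg (bypassˡ x) (b≥0 (suc x))) (weight-nonneg (bypassʳ x) (b≥0 x))

  bypassWeight-off : ∀ {x} → jump x ≡ false → bypassWeight x ≡ + 0
  bypassWeight-off {x} jx = cong₂ (λ s t → weight s (b (suc x)) + weight t (b x))
                       (∨-conicalˡ (bypassˡ x) (bypassʳ x) jx) (∨-conicalʳ (bypassˡ x) (bypassʳ x) jx)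

  regroup : ∀ (Δ : ℕ → ℤ) → Δ d ≡ + 0 →
    sumTo d (λ k → b k * Δ k) ≡ sumTo d (λ k → pathWeight k * Δ k + bypassWeight k * (Δ k + Δ (suc k)))
  regroup Δ Δd≡0 = begin
    sumTo d (λ k → b k * Δ k)
      ≡⟨ sumTo-cong d (λ k _ → split (b k) (bypassWeight k) (shift bypassWeight k) (Δ k)) ⟩
    sumTo d (λ k → own k + shift bypassWeight k * Δ k)
      ≡⟨ sumTo-+ d own (λ k → shift bypassWeight k * Δ k) ⟩
    sumTo d own + sumTo d (λ k → shift bypassWeight k * Δ k)
      ≡⟨ cong (_+_ (sumTo d own)) (sumTo-shift d bypassWeight Δ Δd≡0) ⟩
    sumTo d own + sumTo d (λ k → bypassWeight k * Δ (suc k))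
      ≡⟨ sumTo-+ d own (λ k → bypassWeight k * Δ (suc k)) ⟨
    sumTo d (λ k → own k + bypassWeight k * Δ (suc k))
      ≡⟨ sumTo-cong d (λ k _ → merge (pathWeight k) (bypassWeight k) (Δ k) (Δ (suc k))) ⟩
    sumTo d (λ k → pathWeight k * Δ k + bypassWeight k * (Δ k + Δ (suc k))) ∎
    where
    open ≡-Reasoning
    own : ℕ → ℤ
    own k = pathWeight k * Δ k + bypassWeight k * Δ k
    split : ∀ β j j′ δ → β * δ ≡ ((β - j - j′) * δ + j * δ) + j′ * δ
    split = solve-∀
    merge : ∀ p j δ δ′ → (p * δ + j * δ) + j * δ′ ≡ p * δ + j * (δ + δ′)
    merge = solve-∀

  diff-nonneg : ∀ {v w} → (∀ a → T a ≡ true → w a ≡ 0) → ∀ {x y} → TreePair x y → + 0 ℤ.≤ diff v w x y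
  diff-nonneg {v} {w} w-off-T {x} {y} p = by-cases (y ℕ.<? d)
    where
    by-cases : Dec (y ℕ.< d) → + 0 ℤ.≤ diff v w x y
    by-cases (yes y<d) =
      subst (+ 0 ℤ.≤_) (sym (cong₂ _-_ (extend-arc (λ a → + v a) x<y y<d) (extend-arc (λ a → + w a) x<y y<d)))
      (subst (λ n → + 0 ℤ.≤ + v a - + n) (sym (w-off-T a a∈T)) (ℤP.i≤j⇒0≤j-i (ℤ.+≤+ z≤n)))
      where
      x<y = treePair-< p
      a = arc x<y y<d
      a∈T : T a ≡ true
      a∈T = subst₂ (λ s t → inTree s t ≡ true) (sym (tail-arc x<y y<d)) (sym (head-arc x<y y<d)) (fromTreePair p)
    by-cases (no y≮d) = subst (+ 0 ℤ.≤_)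
      (sym (cong₂ _-_ (extend-outside (λ a → + v a) {x} (ℕP.≮⇒≥ y≮d)) (extend-outside (λ a → + w a) {x} (ℕP.≮⇒≥ y≮d))))
      ℤP.≤-refl

  jump-room : ∀ {x} → jump x ≡ true → 2 ℕ.+ x ℕ.< d
  jump-room {x} jx with bypass-cases (σ (suc x)) (left (suc x)) (σ x) (left x) jx
  ... | inj₁ (σx+1 , _) = ℕP.<-trans (ℕP.n<1+n _) (room σx+1)
  ... | inj₂ (σx , _)   = room σx

  admissible-core : ∀ v w → (∀ a → T a ≡ true → w a ≡ 0) → SameFiber circuitMatrix v w →
    cost (btilde bB) w ℤ.≤ cost (btilde bB) v
  admissible-core v w w-off-T v~w = ℤP.0≤i-j⇒j≤i (subst (+ 0 ℤ.≤_)
    (sym (trans (cost-diff v w) (regroup Δ Δd≡0)))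
    (sumTo-nonneg d (λ k _ → ℤP.+-mono-≤ (path-term k (σ k) refl) (bypass-term k (jump k) refl))))
    where
    Δ : ℕ → ℤ
    Δ k = diff v w k (suc k)
    Δd≡0 : Δ d ≡ + 0
    Δd≡0 = cong₂ _-_ (extend-outside (λ a → + v a) {d} (ℕP.n≤1+n d)) (extend-outside (λ a → + w a) {d} (ℕP.n≤1+n d))
    path-term : ∀ k s → σ k ≡ s → + 0 ℤ.≤ pathWeight k * Δ k
    path-term k true  σk = ℤP.≤-reflexive (sym (trans (cong (_* Δ k) (pathWeight-zero σk)) (ℤP.*-zeroˡ (Δ k))))
    path-term k false σk = *-nonneg (pathWeight-nonneg σk) (diff-nonneg w-off-T (path σk))
    bypass-term : ∀ k s → jump k ≡ s → + 0 ℤ.≤ bypassWeight k * (Δ k + Δ (suc k))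
    bypass-term k true  jk = *-nonneg (bypassWeight-nonneg k)
      (subst (+ 0 ℤ.≤_) (sameFiber-jump v~w (jump-room jk))
                        (diff-nonneg w-off-T (treePair {k} {2 ℕ.+ k} (trans (inTree-jump k) jk))))
    bypass-term k false jk = ℤP.≤-reflexive (sym (trans (cong (_* (Δ k + Δ (suc k))) (bypassWeight-off jk))
                                                       (ℤP.*-zeroˡ (Δ k + Δ (suc k)))))

  unique-tree-arc : ∀ e {xₑ yₑ} {Q : ℕ → ℕ → Set} → toℕ (tail e) ≡ xₑ → toℕ (head e) ≡ yₑ →
    (∀ {x y} → TreePair x y → Q x y → x ≡ xₑ × y ≡ yₑ) →
    ∀ a → T a ≡ true → Q (toℕ (tail a)) (toℕ (head a)) → a ≡ e
  unique-tree-arc e te≡ he≡ only a a∈T q with only (treePair a∈T) q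
  ... | ta≡ , ha≡ = arc-≡ (trans ta≡ (sym te≡)) (trans ha≡ (sym he≡))

  only-crossing : ∀ e {m xₑ yₑ} → toℕ (tail e) ≡ xₑ → toℕ (head e) ≡ yₑ →
    (∀ {x y} → TreePair x y → x ℕ.≤ m → m ℕ.< y → x ≡ xₑ × y ≡ yₑ) →
    ∀ a → T a ≡ true → toℕ (tail a) ℕ.≤ m → m ℕ.< toℕ (head a) → a ≡ e
  only-crossing e {m} te≡ he≡ only a a∈T ta≤m m<ha =
    unique-tree-arc e {Q = λ x y → x ℕ.≤ m × m ℕ.< y} te≡ he≡ (λ p (x≤m , m<y) → only p x≤m m<y)
                    a a∈T (ta≤m , m<ha)

  separating-potential : ∀ e {x y} → TreePair x y → toℕ (tail e) ≡ x → toℕ (head e) ≡ y → ∃[ q ] Separates T e q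
  separating-potential e (path {x} σx) te≡x he≡x+1 with bypassˡ x in A | detour x in B
  ... | true | _ = point (suc x) ,
    sink-separates b≥0 x he≡x+1 (unique-tree-arc e te≡x he≡x+1 (path-sink σx A))
      (left-ok (∧-conicalˡ _ _ A) (∧-conicalʳ _ _ A))
  ... | false | false = cut x ,
    cut-separates b≥0 x (ℕP.≤-reflexive te≡x) (subst (x ℕ.<_) (sym he≡x+1) (ℕP.n<1+n x))
      (only-crossing e te≡x he≡x+1 (path-cut σx A B))
  separating-potential e (path {zero}  σx) _ _ | false | true = clash B refl
  separating-potential e (path {suc x} σx) te≡x+1 he≡x+2 | false | true = (λ y → - point (suc x) y) ,
    source-separates b≥0 x te≡x+1 (unique-tree-arc e te≡x+1 he≡x+2 (path-source σx A))
      (right-ok (∧-conicalˡ _ _ B) (not-true (∧-conicalʳ _ _ B)))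
  separating-potential e (bypass-left {x} σx+1 lx+1) te≡x he≡x+2 = cut (suc x) ,
    cut-separates b≥0 (suc x) (ℕP.≤-trans (ℕP.≤-reflexive te≡x) (ℕP.n≤1+n x))
                              (subst (suc x ℕ.<_) (sym he≡x+2) (ℕP.n<1+n _))
      (only-crossing e te≡x he≡x+2 (bypassˡ-cut σx+1 lx+1))
  separating-potential e (bypass-right {x} σx ¬lx) te≡x he≡x+2 = cut x ,
    cut-separates b≥0 x (ℕP.≤-reflexive te≡x) (subst (x ℕ.<_) (sym he≡x+2) (ℕP.m<n+m x (s≤s z≤n)))
      (only-crossing e te≡x he≡x+2 (bypassʳ-cut σx ¬lx))

  standardPair : StandardPair Ideal zeroVec (coTree T)
  standardPair = admissible , maximal
    where
    coTree-false : ∀ {a} → T a ≡ true → coTree T a ≡ false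
    coTree-false {a} a∈T = trans (coTree-not T a) (cong not a∈T)
    coTree-true : ∀ {a} → T a ≡ false → coTree T a ≡ true
    coTree-true {a} a∉T = trans (coTree-not T a) (cong not a∉T)
    admissible : Admissible Ideal zeroVec (coTree T)
    admissible = (λ _ _ → refl) , λ w w-off-coT (v , v~w , v<w) →
      ℤP.<⇒≱ v<w (admissible-core v w (λ a a∈T → w-off-coT a (coTree-false {a} a∈T)) v~w)
    maximal : ∀ b′ τ → Admissible Ideal b′ τ → PairLeq zeroVec (coTree T) b′ τ →
      (∀ e → b′ e ≡ zeroVec e) × (∀ e → τ e ≡ coTree T e)
    maximal b′ τ adm above = (λ e → ℕP.n≤0⇒n≡0 (proj₁ above e)) , λ e → by-cases e (T e) refl
      where
      by-cases : ∀ e t → T e ≡ t → τ e ≡ coTree T e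
      by-cases e true e∈T with separating-potential e (treePair e∈T) refl refl
      ... | _ , separates =
        trans (separated-arc-outside gen {T} {e} e∈T separates adm above) (sym (coTree-false {e} e∈T))
      by-cases e false e∉T = trans (proj₂ above e (inj₂ (coTree-true {e} e∉T))) (sym (coTree-true {e} e∉T))

member : ∀ {n} → Subset n → ℕ → Bool
member []      _       = false
member (x ∷ p) zero    = x
member (x ∷ p) (suc k) = member p k

member-lookup : ∀ {n} (p : Subset n) i → member p (toℕ i) ≡ lookup p i
member-lookup (x ∷ p) Fin.zero    = refl
member-lookup (x ∷ p) (Fin.suc i) = member-lookup p i

∈⇒member : ∀ {n} (p : Subset n) {i} → i ∈ p → member p (toℕ i) ≡ true
∈⇒member p {i} i∈p = trans (member-lookup p i) (VecP.[]=⇒lookup i∈p)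

∉⇒¬member : ∀ {n} (p : Subset n) {i} → i ∉ p → member p (toℕ i) ≡ false
∉⇒¬member p {i} i∉p = ¬-not (λ pi → i∉p (VecP.lookup⇒[]= i p (trans (sym (member-lookup p i)) pi)))

member-< : ∀ {n} (p : Subset n) {k} → member p k ≡ true → k ℕ.< n
member-< (x ∷ p) {zero}  _  = s≤s z≤n
member-< (x ∷ p) {suc k} pk = s≤s (member-< p pk)

member-∈ : ∀ {n} (p : Subset n) {k} (pk : member p k ≡ true) → Fin.fromℕ< (member-< p pk) ∈ p
member-∈ p {k} pk = VecP.lookup⇒[]= _ p
  (trans (sym (member-lookup p _)) (subst (λ z → member p z ≡ true) (sym (FinP.toℕ-fromℕ< _)) pk))

∈-tabulate⁺ : ∀ {n} (f : Fin n → Bool) {i} → f i ≡ true → i ∈ tabulate f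
∈-tabulate⁺ f {i} fi = VecP.lookup⇒[]= i (tabulate f) (trans (VecP.lookup∘tabulate f i) fi)

∈-tabulate⁻ : ∀ {n} (f : Fin n → Bool) {i} → i ∈ tabulate f → f i ≡ true
∈-tabulate⁻ f {i} i∈ = trans (sym (VecP.lookup∘tabulate f i)) (VecP.[]=⇒lookup i∈)

module Selection (d : ℕ) (bB : TreeArc d → ℤ) where

  open CostsAndFibres d bB

  n q : ℕ
  n = d ∸ 1
  q = n / 6

  left right good : ℕ → Bool
  left  t = does (b t ℤ.≤? b (t ∸ 1))
  right t = does (b t ℤ.≤? b (suc t))
  good  t = left t ∨ right t

  -- One index from each block 6j, …, 6j + 5: 6j + 2 is taken only when 6j + 1 is not good, and
  -- then b (6j + 2) < b (6j + 1) makes 6j + 2 good.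
  pick : ℕ → ℕ
  pick j = if good (suc (j ℕ.* 6)) then suc (j ℕ.* 6) else 2 ℕ.+ j ℕ.* 6

  left-sound : ∀ {t} → left t ≡ true → b t ℤ.≤ b (t ∸ 1)
  left-sound {t} = does-true (b t ℤ.≤? b (t ∸ 1))

  pick-bounds : ∀ j → suc (j ℕ.* 6) ℕ.≤ pick j × pick j ℕ.≤ 2 ℕ.+ j ℕ.* 6
  pick-bounds j = by-cases (good (suc (j ℕ.* 6)))
    where
    by-cases : ∀ c → let p = if c then suc (j ℕ.* 6) else 2 ℕ.+ j ℕ.* 6 in
      suc (j ℕ.* 6) ℕ.≤ p × p ℕ.≤ 2 ℕ.+ j ℕ.* 6
    by-cases true  = ℕP.≤-refl , ℕP.n≤1+n _
    by-cases false = ℕP.n≤1+n _ , ℕP.≤-refl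

  pick-below-next : ∀ j → 3 ℕ.+ pick j ℕ.≤ suc j ℕ.* 6
  pick-below-next j = ℕP.≤-trans (ℕP.+-monoʳ-≤ 3 (proj₂ (pick-bounds j))) (ℕP.n≤1+n _)

  pick-gap : ∀ {j j′} → j ℕ.< j′ → 3 ℕ.+ pick j ℕ.≤ pick j′
  pick-gap {j} {j′} j<j′ = ℕP.≤-trans (pick-below-next j)
    (ℕP.≤-trans (ℕP.*-monoˡ-≤ 6 j<j′) (ℕP.≤-trans (ℕP.n≤1+n _) (proj₁ (pick-bounds j′))))

  pick-room : ∀ {j} → j ℕ.< q → 3 ℕ.+ pick j ℕ.≤ n
  pick-room {j} j<q = ℕP.≤-trans (pick-below-next j) (ℕP.≤-trans (ℕP.*-monoˡ-≤ 6 j<q) (m/n*n≤m n 6))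

  pick-right : ∀ j → left (pick j) ≡ false → b (pick j) ℤ.≤ b (suc (pick j))
  pick-right j = by-cases (good (suc (j ℕ.* 6))) refl
    where
    t = suc (j ℕ.* 6)
    by-cases : ∀ c → good t ≡ c → let p = if c then t else suc t in left p ≡ false → b p ℤ.≤ b (suc p)
    by-cases true  good-t ¬left-t = does-true (b t ℤ.≤? b (suc t)) (trans (sym (cong (_∨ right t) ¬left-t)) good-t)
    by-cases false good-t ¬left-t+1 = clash (dec-true (b (suc t) ℤ.≤? b t) (ℤP.<⇒≤ (ℤP.≰⇒> b[t]≰b[t+1]))) ¬left-t+1
      where
      b[t]≰b[t+1] : ¬ b t ℤ.≤ b (suc t)
      b[t]≰b[t+1] = does-false (b t ℤ.≤? b (suc t)) (∨-conicalʳ (left t) (right t) good-t)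

  chosen : ℕ → ℕ → Bool
  chosen m t = does (FinP.any? {n = m} λ j → t ℕ.≟ pick (toℕ j))

  chosen-intro : ∀ m {t j} → j ℕ.< m → t ≡ pick j → chosen m t ≡ true
  chosen-intro m {t} j<m t≡ = dec-true (FinP.any? {n = m} λ j → t ℕ.≟ pick (toℕ j))
    (Fin.fromℕ< j<m , trans t≡ (cong pick (sym (FinP.toℕ-fromℕ< j<m))))

  chosen-elim : ∀ m t → chosen m t ≡ true → Σ ℕ λ j → j ℕ.< m × t ≡ pick j
  chosen-elim m t ct with does-true (FinP.any? {n = m} λ j → t ℕ.≟ pick (toℕ j)) ct
  ... | j , t≡ = toℕ j , FinP.toℕ<n j , t≡

  Chosen : ℕ → Subset n
  Chosen m = tabulate (λ i → chosen m (toℕ i))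

  Chosen-grows : ∀ {m} → suc m ℕ.≤ q → Chosen m ⊂ Chosen (suc m)
  Chosen-grows {m} m<q =
    grow , new , ∈-tabulate⁺ (λ i → chosen (suc m) (toℕ i)) (chosen-intro (suc m) (ℕP.n<1+n m) (FinP.toℕ-fromℕ< pick<n)) , old
    where
    grow : Chosen m ⊆ Chosen (suc m)
    grow {x} x∈ with chosen-elim m (toℕ x) (∈-tabulate⁻ (λ i → chosen m (toℕ i)) x∈)
    ... | j , j<m , x≡ = ∈-tabulate⁺ (λ i → chosen (suc m) (toℕ i)) (chosen-intro (suc m) (ℕP.m<n⇒m<1+n j<m) x≡)
    pick<n : pick m ℕ.< n
    pick<n = ℕP.≤-trans (ℕP.m≤n+m (suc (pick m)) 2) (pick-room {m} m<q)
    new : Fin n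
    new = Fin.fromℕ< pick<n
    old : new ∉ Chosen m
    old new∈ with chosen-elim m (toℕ new) (∈-tabulate⁻ (λ i → chosen m (toℕ i)) new∈)
    ... | j , j<m , new≡ = ℕP.<-irrefl (trans (sym new≡) (FinP.toℕ-fromℕ< pick<n))
                             (ℕP.<-≤-trans (ℕP.m<n+m (pick j) {3} (s≤s z≤n)) (pick-gap j<m))

  ∣Chosen∣ : ∀ m → m ℕ.≤ q → m ℕ.≤ ∣ Chosen m ∣
  ∣Chosen∣ zero    _     = z≤n
  ∣Chosen∣ (suc m) m<q = ℕP.≤-trans (s≤s (∣Chosen∣ m (ℕP.<⇒≤ m<q))) (p⊂q⇒∣p∣<∣q∣ (Chosen-grows m<q))

  S : Subset n
  S = Chosen q

  module _ {σ : Subset n} (σ⊆S : σ ⊆ S) where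

    σ-picked : ∀ {t} → member σ t ≡ true → Σ ℕ λ j → j ℕ.< q × t ≡ pick j
    σ-picked {t} σt = chosen-elim q t (subst (λ z → chosen q z ≡ true) (FinP.toℕ-fromℕ< (member-< σ σt))
                                     (∈-tabulate⁻ (λ i → chosen q (toℕ i)) (σ⊆S (member-∈ σ σt))))

    σ-sparse : Sparse d (member σ)
    σ-sparse = record { positive = positive ; room = room ; apart = apart }
      where
      positive : ∀ {t} → member σ t ≡ true → 1 ℕ.≤ t
      positive σt with σ-picked σt
      ... | j , _ , refl = ℕP.≤-trans (s≤s z≤n) (proj₁ (pick-bounds j))
      room : ∀ {t} → member σ t ≡ true → 2 ℕ.+ t ℕ.< d
      room σt with σ-picked σt
      ... | j , j<q , refl = ℕP.≤-trans (pick-room j<q) (ℕP.m∸n≤m d 1)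
      apart : ∀ {t t′} → member σ t ≡ true → member σ t′ ≡ true → t ℕ.< t′ → 3 ℕ.+ t ℕ.≤ t′
      apart σt σt′ t<t′ with σ-picked σt | σ-picked σt′
      ... | j , _ , refl | j′ , _ , refl with ℕP.<-cmp j j′
      ...   | tri< j<j′ _ _ = pick-gap j<j′
      ...   | tri≈ _ refl _ = contradiction t<t′ (ℕP.<-irrefl refl)
      ...   | tri> _ _ j′<j = contradiction t<t′ (ℕP.<⇒≯ (ℕP.<-≤-trans (ℕP.m<n+m _ (s≤s z≤n)) (pick-gap j′<j)))

    σ-right : ∀ {t} → member σ t ≡ true → left t ≡ false → b t ℤ.≤ b (suc t)
    σ-right σt with σ-picked σt
    ... | j , _ , refl = pick-right j

theorem5p7 : (d : ℕ) (bB : TreeArc d → ℤ) →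
    Generic circuitMatrix (btilde bB) →
    (∃[ x ] (∀ t → mulVec cutsetMatrix x t ≡ bB t)) →
    ∃[ S ] (((d ∸ 1) / 6 ≤ ∣ S ∣) ×
      (∀ (σ : Subset (d ∸ 1)) → σ ⊆ S →
        ∃[ T ] (SpanningTree T ×
          (∀ k → k ∈ S → k ∉ σ → ∀ a → IsPathArc k a → T a ≡ true) ×
          (∀ k → k ∈ σ → ∀ a → IsPathArc k a → T a ≡ false) ×
          StandardPair (InInitialIdeal circuitMatrix (btilde bB))
            zeroVec (coTree T))))
theorem5p7 d bB gen solution = S , ∣Chosen∣ q ℕP.≤-refl , λ σ σ⊆S →
  let open Bypass (σ-sparse σ⊆S) left
      open BypassStandardPair bB gen (σ-sparse σ⊆S) left (b-nonneg solution) (λ {t} _ → left-sound {t}) (σ-right σ⊆S)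
  in T , spanning ,
     (λ k _ k∉σ a (tail≡k , head≡k+1) → trans (T-path a tail≡k head≡k+1) (cong not (∉⇒¬member σ k∉σ))) ,
     (λ k k∈σ a (tail≡k , head≡k+1) → trans (T-path a tail≡k head≡k+1) (cong not (∈⇒member σ k∈σ))) ,
     standardPair
  where
  open CostsAndFibres d bB using (b-nonneg)
  open Selection d bB
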